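{- Let $s\ge 2$, $p\ge 2$ be integers and let $G\in\mathcal{G}(s,p)$ be different from $G_{min}(s,p)$ and from $G_{max}(s,p)$. Let $H$ be the subgraph of $G$ induced by the set of its $2p$ simplicial vertices (so $H=H_1\cup H_2$ with $H_j=G[P_j]$ a disjoint union of complete graphs $K_{p^j_1},\dots,K_{p^j_{r_j}}$, where $p^j_1+\dots+p^j_{r_j}=p$ is a partition of $p$, $j=1,2$). Let $\mu_1(L(H))\ge\dots\ge\mu_{2(p-1)}(L(H))$ be all the Laplacian eigenvalues of $H$ except the two smallest ones. Then the Laplacian spectrum of $G$ is $$\Big[\tfrac{3s+p+\sqrt{(s+p)^2+4sp}}{2};\ (2s+p)^{2(s-1)};\ s+p;\ s+\mu_1(L(H));\ \dots;\ s+\mu_{2(p-1)}(L(H));\ \tfrac{3s+p-\sqrt{(s+p)^2+4sp}}{2};\ 0\Big],$$ where $x^{m}$ denotes the eigenvalue $x$ with multiplicity $m$ (eigenvalues without exponent have multiplicity $1$).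
   Context: All graphs are finite, simple and connected. The Laplacian matrix of $G$ is $L(G)=\mathcal{D}(G)-A(G)$ (degree matrix minus adjacency matrix); the Laplacian spectrum is the multiset of its eigenvalues. A vertex is simplicial if its neighbourhood is a clique. A minimal vertex separator is a set $S$ that, for some non-adjacent vertices $u,v$, separates $u$ and $v$ into different components of $G-S$ and is inclusion-minimal with this property. A graph is strictly chordal if it is obtained from a block graph (connected graph all of whose blocks are cliques) by adding zero or more true twins ($N[u]=N[v]$) to each vertex; a strictly interval graph is one that is both strictly chordal and an interval graph. For integers $s,p\ge 2$, $\mathcal{G}(s,p)$ is the set of $SI$-core graphs: strictly interval graphs $G$ with exactly two minimal vertex separators $S_1,S_2$, $|S_1|=|S_2|=s$, $S_1\cup S_2$ a maximal clique of $G$, and each $S_i$ having exactly $p$ simplicial vertices adjacent to it. Explicitly, $V(G)=S_1\cup S_2\cup P_1\cup P_2$ (disjoint), $|P_i|=p$, $P_i$ being the simplicial vertices adjacent to $S_i$, every vertex of $P_i$ is adjacent to all of $S_i$ and to no vertex of $S_{3-i}\cup P_{3-i}$, and $G[P_i]$ is a disjoint union of complete graphs. $G_{min}(s,p)$ (resp. $G_{max}(s,p)$) is the member of $\mathcal{G}(s,p)$ with the minimum (resp. maximum) number of edges, i.e. $P_1,P_2$ independent sets (resp. cliques). -}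

module Defs where

import Data.Nat
open import Data.Nat using (ℕ; zero; suc)
open import Data.Integer using (ℤ; +_; _+_; _-_; _*_; -_; _^_)
open import Data.Fin using (Fin; zero; suc; toℕ; punchIn; _≟_)
open import Data.Bool using (Bool; true; false; if_then_else_)
open import Data.List using (List; length; lookup; filterᵇ; allFin)
open import Data.Product using (Σ; _×_)
open import Data.Sum using (_⊎_)
open import Relation.Nullary using (¬_; does)
open import Relation.Binary.PropositionalEquality using (_≡_)

sumFin : ∀ {n} → (Fin n → ℤ) → ℤ
sumFin {zero}  f = + 0
sumFin {suc n} f = f zero + sumFin (λ i → f (suc i))

sign : ℕ → ℤ
sign zero = + 1
sign (suc k) = - sign k

det : ∀ n → (Fin n → Fin n → ℤ) → ℤ
det zero    M = + 1
det (suc n) M =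
  sumFin (λ j → sign (toℕ j) * M zero j * det n (λ i k → M (suc i) (punchIn j k)))

charPoly : ∀ {n} → (Fin n → Fin n → ℤ) → ℤ → ℤ
charPoly {n} M x = det n (λ i j → (if does (i ≟ j) then x else + 0) - M i j)

b2z : Bool → ℤ
b2z true  = + 1
b2z false = + 0

record IsSimpleGraph {n : ℕ} (adj : Fin n → Fin n → Bool) : Set where
  field
    symmetric   : ∀ u v → adj u v ≡ adj v u
    irreflexive : ∀ u → adj u u ≡ false

degree : ∀ {n} → (Fin n → Fin n → Bool) → Fin n → ℤ
degree adj u = sumFin (λ v → b2z (adj u v))

laplacian : ∀ {n} → (Fin n → Fin n → Bool) → Fin n → Fin n → ℤ
laplacian adj i j = if does (i ≟ j) then degree adj i else - b2z (adj i j)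

inducedVerts : ∀ {n} → (Fin n → Bool) → List (Fin n)
inducedVerts {n} P = filterᵇ P (allFin n)

inducedAdj : ∀ {n} (adj : Fin n → Fin n → Bool) (P : Fin n → Bool) →
             Fin (length (inducedVerts P)) → Fin (length (inducedVerts P)) → Bool
inducedAdj adj P i j = adj (lookup (inducedVerts P) i) (lookup (inducedVerts P) j)

-- SI-core graphs: V = S₁ ⊎ S₂ ⊎ P₁ ⊎ P₂ given by a labelling

data Part : Set where
  S₁ S₂ P₁ P₂ : Part

count : ∀ {n} → (Fin n → Bool) → ℕ
count P = length (inducedVerts P)

isLab : Part → Part → Bool
isLab S₁ S₁ = true
isLab S₂ S₂ = true
isLab P₁ P₁ = true
isLab P₂ P₂ = true
isLab _  _  = false

isS : Part → Bool
isS S₁ = true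
isS S₂ = true
isS _  = false

isP : Part → Bool
isP P₁ = true
isP P₂ = true
isP _  = false

-- membership of G in 𝒢(s,p), via the explicit description
record IsSICore (s p : ℕ) {n : ℕ} (adj : Fin n → Fin n → Bool)
                (lab : Fin n → Part) : Set where
  field
    card-S₁ : count (λ v → isLab S₁ (lab v)) ≡ s
    card-S₂ : count (λ v → isLab S₂ (lab v)) ≡ s
    card-P₁ : count (λ v → isLab P₁ (lab v)) ≡ p
    card-P₂ : count (λ v → isLab P₂ (lab v)) ≡ p
    S-clique : ∀ u v → ¬ (u ≡ v) → isS (lab u) ≡ true → isS (lab v) ≡ true →
               adj u v ≡ true
    P₁S₁ : ∀ u v → lab u ≡ P₁ → lab v ≡ S₁ → adj u v ≡ true
    P₂S₂ : ∀ u v → lab u ≡ P₂ → lab v ≡ S₂ → adj u v ≡ true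
    P₁-far : ∀ u v → lab u ≡ P₁ → (lab v ≡ S₂ ⊎ lab v ≡ P₂) → adj u v ≡ false
    P₂-far : ∀ u v → lab u ≡ P₂ → (lab v ≡ S₁ ⊎ lab v ≡ P₁) → adj u v ≡ false
    -- G[P_i] is a disjoint union of complete graphs (adjacency transitive)
    P-cluster : ∀ u v w → lab u ≡ lab v → lab v ≡ lab w → isP (lab u) ≡ true →
                adj u v ≡ true → adj v w ≡ true → ¬ (u ≡ w) → adj u w ≡ true

-- G ≠ G_min(s,p): some P_i is not an independent set
NotMin : ∀ {n} → (Fin n → Fin n → Bool) → (Fin n → Part) → Set
NotMin adj lab = Σ _ λ u → Σ _ λ v →
  lab u ≡ lab v × isP (lab u) ≡ true × adj u v ≡ true

-- G ≠ G_max(s,p): some P_i is not a clique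
NotMax : ∀ {n} → (Fin n → Fin n → Bool) → (Fin n → Part) → Set
NotMax adj lab = Σ _ λ u → Σ _ λ v →
  lab u ≡ lab v × isP (lab u) ≡ true × ¬ (u ≡ v) × adj u v ≡ false

twoSMinus2 : ℕ → ℕ
twoSMinus2 s = 2 Data.Nat.* (s Data.Nat.∸ 1)

{-# OPTIONS --safe #-}
-- Write M = xI − L(G), a = x − (2s + p), b = x − s, and fix u₁ ∈ S₁, u₂ ∈ S₂.  Integer row
-- operations compute det M · b².  All rows of S_σ agree off the diagonal, so subtracting row u_σ
-- from each other row v of S_σ leaves a(e_v − e_{u_σ}): this gives the factor a^{2(s−1)}.  After
-- scaling rows u₁, u₂ by b, subtracting the rows of P_σ (which sum to p on S_σ and to b on P_σ) and
-- multiples of the rows e_v − e_{u_τ} turns row u_σ into κ e_{u_σ} + β e_{u_τ} (τ the other side),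
-- and this 2 × 2 block contributes (κ + β)(κ − β) = x(x − s − p)(x² − (3s + p)x + 2s²).  What is
-- left is the block of the simplicial rows, which is (x − s)I − L(H): every simplicial vertex has
-- exactly s neighbours outside H.

module Submission where

open import Defs
open import Function using (_∘_; const; id)
open import Data.Nat using (ℕ; zero; suc; _≤_; s≤s)
import Data.Nat as ℕ
open import Data.Nat.Properties using (suc-injective; +-cancelʳ-≡)
import Data.Nat.Tactic.RingSolver as ℕ-Solver
open import Data.Integer using (ℤ; +_; +0; +[1+_]; -[1+_]; _+_; _-_; _*_; -_; _^_)
import Data.Integer.Properties as ℤ
open import Data.Integer.Tactic.RingSolver using (solve-∀)
open import Data.Fin as Fin using (Fin; zero; suc; toℕ; punchIn; pinch; cast; _≟_)
open import Data.Fin.Properties using (punchInᵢ≢i; punchIn-injective; cast-is-id; any?)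
open import Data.Vec.Functional using (updateAt)
open import Data.Vec.Functional.Properties using (updateAt-updates; updateAt-minimal; updateAt-id-local)
open import Data.Bool using (Bool; true; false; not; _∧_; _∨_; T; if_then_else_)
import Data.Bool.Properties as Bool
open import Data.List using (List; []; _∷_; length; lookup; map; filterᵇ; allFin; tabulate)
open import Data.List.Properties using (length-map; map-tabulate; map-∘; length-tabulate; lookup-tabulate; filter-all)
open import Data.List.Relation.Unary.All as All using (universal)
open import Data.List.Relation.Unary.All.Properties using (all-filter)
open import Data.List.Relation.Unary.AllPairs using (_∷_)
open import Data.List.Relation.Unary.Unique.Propositional using (Unique)
import Data.List.Relation.Unary.Unique.Propositional.Properties as Unique
open import Data.List.Membership.Propositional.Properties using (∈-lookup)
open import Data.Product using (Σ; _,_; _×_; proj₁; proj₂)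
open import Data.Sum using (_⊎_; inj₁; inj₂)
open import Function.Bundles using (Equivalence)
open import Data.Empty using (⊥-elim)
open import Relation.Nullary using (does; yes; no)
open import Relation.Nullary.Decidable using (T?; dec-true; dec-false)
open import Relation.Binary.PropositionalEquality
open import Algebra.Properties.Semiring.Sum ℤ.+-*-semiring
  using (sum; sum-syntax; sum-cong-≗; sum-replicate-zero; sum-remove; ∑-distrib-+; ∑-comm; *-distribˡ-sum; *-distribʳ-sum)
open ≡-Reasoning

private variable
  n : ℕ

-- Finite sums

sumFin≡sum : (f : Fin n → ℤ) → sumFin f ≡ sum f
sumFin≡sum {zero}  f = refl
sumFin≡sum {suc n} f = cong (_+_ (f zero)) (sumFin≡sum (f ∘ suc))

∑-zero : {f : Fin n → ℤ} → (∀ i → f i ≡ + 0) → sum f ≡ + 0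
∑-zero {n} f≡0 = trans (sum-cong-≗ f≡0) (sum-replicate-zero n)

∑-neg : (f : Fin n → ℤ) → ∑[ i < n ] (- f i) ≡ - sum f
∑-neg {zero}  f = refl
∑-neg {suc n} f = trans (cong (_+_ (- f zero)) (∑-neg (f ∘ suc))) (sym (ℤ.neg-distrib-+ (f zero) _))

∑-combination₃ : (c₁ c₂ c₃ : ℤ) (f g h : Fin n → ℤ) →
  ∑[ v < n ] (c₁ * f v + c₂ * g v + c₃ * h v) ≡ c₁ * sum f + c₂ * sum g + c₃ * sum h
∑-combination₃ c₁ c₂ c₃ f g h = begin
  ∑[ v < _ ] (c₁ * f v + c₂ * g v + c₃ * h v)              ≡⟨ ∑-distrib-+ (λ v → c₁ * f v + c₂ * g v) (λ v → c₃ * h v) ⟩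
  ∑[ v < _ ] (c₁ * f v + c₂ * g v) + ∑[ v < _ ] (c₃ * h v) ≡⟨ cong (_+ _) (∑-distrib-+ (λ v → c₁ * f v) (λ v → c₂ * g v)) ⟩
  ∑[ v < _ ] (c₁ * f v) + ∑[ v < _ ] (c₂ * g v) + ∑[ v < _ ] (c₃ * h v)
      ≡⟨ cong₂ _+_ (cong₂ _+_ (*-distribˡ-sum c₁ f) (*-distribˡ-sum c₂ g)) (*-distribˡ-sum c₃ h) ⟨
  c₁ * sum f + c₂ * sum g + c₃ * sum h                     ∎

δ : Fin n → Fin n → ℤ
δ u v = b2z (does (u ≟ v))

δ-refl : (u : Fin n) → δ u u ≡ + 1
δ-refl u = cong b2z (dec-true (u ≟ u) refl)

δ-≢ : {u v : Fin n} → u ≢ v → δ u v ≡ + 0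
δ-≢ {u = u} {v} u≢v = cong b2z (dec-false (u ≟ v) u≢v)

δ-sym : (u v : Fin n) → δ u v ≡ δ v u
δ-sym u v with u ≟ v | v ≟ u
... | yes _   | yes _   = refl
... | no _    | no _    = refl
... | yes u≡v | no v≢u = ⊥-elim (v≢u (sym u≡v))
... | no u≢v  | yes v≡u = ⊥-elim (u≢v (sym v≡u))

∑-δ : (u : Fin n) (f : Fin n → ℤ) → ∑[ v < n ] (δ u v * f v) ≡ f u
∑-δ {suc n} u f = begin
  sum (λ v → δ u v * f v)                                           ≡⟨ sum-remove {i = u} (λ v → δ u v * f v) ⟩
  δ u u * f u + ∑[ i < n ] (δ u (punchIn u i) * f (punchIn u i))
      ≡⟨ cong₂ _+_ (cong (_* f u) (δ-refl u)) (∑-zero off-diagonal) ⟩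
  + 1 * f u + + 0                                                    ≡⟨ ℤ.+-identityʳ _ ⟩
  + 1 * f u                                                          ≡⟨ ℤ.*-identityˡ _ ⟩
  f u                                                                ∎
  where
  off-diagonal : ∀ i → δ u (punchIn u i) * f (punchIn u i) ≡ + 0
  off-diagonal i = trans (cong (_* f (punchIn u i)) (δ-≢ (λ u≡ → punchInᵢ≢i u i (sym u≡)))) (ℤ.*-zeroˡ (f (punchIn u i)))

∑-δ₁ : (u : Fin n) → ∑[ v < n ] δ u v ≡ + 1
∑-δ₁ u = trans (sum-cong-≗ (λ v → sym (ℤ.*-identityʳ (δ u v)))) (∑-δ u (const (+ 1)))

∑-pair : (A : Fin n → Fin n → ℤ) (u v : Fin n) (a b : ℤ) (j : Fin n) →
  ∑[ w < n ] ((a * δ u w + b * δ v w) * A w j) ≡ a * A u j + b * A v j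
∑-pair {n} A u v a b j = begin
  ∑[ w < n ] ((a * δ u w + b * δ v w) * A w j)
      ≡⟨ sum-cong-≗ (λ w → distribute a b (δ u w) (δ v w) (A w j)) ⟩
  ∑[ w < n ] (δ u w * (a * A w j) + δ v w * (b * A w j))
      ≡⟨ ∑-distrib-+ (λ w → δ u w * (a * A w j)) (λ w → δ v w * (b * A w j)) ⟩
  ∑[ w < n ] (δ u w * (a * A w j)) + ∑[ w < n ] (δ v w * (b * A w j))
      ≡⟨ cong₂ _+_ (∑-δ u (λ w → a * A w j)) (∑-δ v (λ w → b * A w j)) ⟩
  a * A u j + b * A v j                                           ∎
  where
  distribute : ∀ a b du dv x → (a * du + b * dv) * x ≡ du * (a * x) + dv * (b * x)
  distribute = solve-∀

-- Induced vertex lists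

filterᵇ-map : ∀ {A B : Set} (R : B → Bool) (g : A → B) (xs : List A) →
  filterᵇ R (map g xs) ≡ map g (filterᵇ (R ∘ g) xs)
filterᵇ-map R g []       = refl
filterᵇ-map R g (x ∷ xs) with R (g x)
... | true  = cong (g x ∷_) (filterᵇ-map R g xs)
... | false = filterᵇ-map R g xs

tabulate-suc : tabulate {n = n} Fin.suc ≡ map Fin.suc (allFin n)
tabulate-suc = sym (map-tabulate id Fin.suc)

mutual
  inducedVerts-punchIn : (R : Fin (suc n) → Bool) (u : Fin (suc n)) → R u ≡ false →
    inducedVerts R ≡ map (punchIn u) (inducedVerts (R ∘ punchIn u))
  inducedVerts-punchIn {n} R zero Ru rewrite Ru =
    trans (cong (filterᵇ R) tabulate-suc) (filterᵇ-map R Fin.suc (allFin n))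
  inducedVerts-punchIn {suc n} R (suc u) Ru with R zero
  ... | true  = cong (zero ∷_) (filterᵇ-tabulate-suc-punchIn R u Ru)
  ... | false = filterᵇ-tabulate-suc-punchIn R u Ru

  filterᵇ-tabulate-suc-punchIn : (R : Fin (suc (suc n)) → Bool) (u : Fin (suc n)) → R (suc u) ≡ false →
    filterᵇ R (tabulate Fin.suc) ≡ map (punchIn (suc u)) (filterᵇ (R ∘ punchIn (suc u)) (tabulate Fin.suc))
  filterᵇ-tabulate-suc-punchIn {n} R u Ru = begin
    filterᵇ R (tabulate Fin.suc)                          ≡⟨ cong (filterᵇ R) tabulate-suc ⟩
    filterᵇ R (map Fin.suc (allFin (suc n)))              ≡⟨ filterᵇ-map R Fin.suc (allFin (suc n)) ⟩
    map Fin.suc (inducedVerts (R ∘ Fin.suc))              ≡⟨ cong (map Fin.suc) (inducedVerts-punchIn (R ∘ Fin.suc) u Ru) ⟩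
    map Fin.suc (map (punchIn u) V)                       ≡⟨ map-∘ V ⟨
    map (punchIn (suc u) ∘ Fin.suc) V                     ≡⟨ map-∘ V ⟩
    map (punchIn (suc u)) (map Fin.suc V)
        ≡⟨ cong (map (punchIn (suc u))) (filterᵇ-map (R ∘ punchIn (suc u)) Fin.suc (allFin n)) ⟨
    map (punchIn (suc u)) (filterᵇ (R ∘ punchIn (suc u)) (map Fin.suc (allFin n)))
        ≡⟨ cong (λ xs → map (punchIn (suc u)) (filterᵇ (R ∘ punchIn (suc u)) xs)) tabulate-suc ⟨
    map (punchIn (suc u)) (filterᵇ (R ∘ punchIn (suc u)) (tabulate Fin.suc)) ∎
    where V = inducedVerts (R ∘ Fin.suc ∘ punchIn u)

∑-lookup-filterᵇ : ∀ {A : Set} (R : A → Bool) (f : A → ℤ) (xs : List A) →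
  ∑[ k < length (filterᵇ R xs) ] f (lookup (filterᵇ R xs) k)
    ≡ ∑[ k < length xs ] (b2z (R (lookup xs k)) * f (lookup xs k))
∑-lookup-filterᵇ R f []       = refl
∑-lookup-filterᵇ R f (x ∷ xs) with R x
... | true  = cong₂ _+_ (sym (ℤ.*-identityˡ (f x))) (∑-lookup-filterᵇ R f xs)
... | false = trans (∑-lookup-filterᵇ R f xs) (sym (ℤ.+-identityˡ _))

∑-lookup-tabulate : ∀ {A : Set} (h : Fin n → A) (f : A → ℤ) →
  ∑[ k < length (tabulate h) ] f (lookup (tabulate h) k) ≡ ∑[ i < n ] f (h i)
∑-lookup-tabulate {zero}  h f = refl
∑-lookup-tabulate {suc n} h f = cong (_+_ (f (h zero))) (∑-lookup-tabulate (h ∘ suc) f)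

∑-inducedVerts : (R : Fin n → Bool) (f : Fin n → ℤ) →
  ∑[ k < count R ] f (lookup (inducedVerts R) k) ≡ ∑[ v < n ] (b2z (R v) * f v)
∑-inducedVerts {n} R f =
  trans (∑-lookup-filterᵇ R f (allFin n)) (∑-lookup-tabulate id (λ v → b2z (R v) * f v))

∑-one : ∀ m → ∑[ k < m ] (+ 1) ≡ + m
∑-one zero    = refl
∑-one (suc m) = trans (cong (_+_ (+ 1)) (∑-one m)) (sym (ℤ.pos-+ 1 m))

count-as-∑ : (R : Fin n → Bool) → + count R ≡ ∑[ v < n ] b2z (R v)
count-as-∑ R = begin
  + count R                                ≡⟨ ∑-one (count R) ⟨
  ∑[ k < count R ] (+ 1)                   ≡⟨ ∑-inducedVerts R (const (+ 1)) ⟩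
  ∑[ v < _ ] (b2z (R v) * + 1)             ≡⟨ sum-cong-≗ (λ v → ℤ.*-identityʳ (b2z (R v))) ⟩
  ∑[ v < _ ] b2z (R v)                     ∎

without : (Fin n → Bool) → Fin n → Fin n → Bool
without X u i = not (does (u ≟ i)) ∧ X i

without-true : (X : Fin n → Bool) (u : Fin n) {v : Fin n} → without X u v ≡ true → u ≢ v × X v ≡ true
without-true X u {v} X′v with u ≟ v
... | no u≢v = u≢v , X′v

count-without : (X : Fin n → Bool) {u : Fin n} → X u ≡ true → count X ≡ suc (count (without X u))
count-without {n} X {u} Xu = ℤ.+-injective (begin
  + count X                                          ≡⟨ count-as-∑ X ⟩
  ∑[ i < n ] b2z (X i)                               ≡⟨ sum-cong-≗ split ⟩
  ∑[ i < n ] (δ u i + b2z (without X u i))           ≡⟨ ∑-distrib-+ (δ u) (λ i → b2z (without X u i)) ⟩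
  ∑[ i < n ] δ u i + ∑[ i < n ] b2z (without X u i)  ≡⟨ cong₂ _+_ (∑-δ₁ u) (sym (count-as-∑ (without X u))) ⟩
  + 1 + + count (without X u)                        ≡⟨ ℤ.pos-+ 1 (count (without X u)) ⟨
  + suc (count (without X u))                        ∎)
  where
  split : ∀ i → b2z (X i) ≡ δ u i + b2z (without X u i)
  split i with u ≟ i
  ... | yes refl rewrite Xu = refl
  ... | no _     = sym (ℤ.+-identityˡ _)

count-none : (X : Fin n → Bool) → (∀ i → X i ≡ false) → count X ≡ 0
count-none X none = ℤ.+-injective (trans (count-as-∑ X) (∑-zero (λ i → cong b2z (none i))))

count≡suc⇒∃ : (R : Fin n → Bool) {k : ℕ} → count R ≡ suc k → Σ (Fin n) (λ u → R u ≡ true)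
count≡suc⇒∃ R cnt with any? (λ u → R u Bool.≟ true)
... | yes found = found
... | no none with () ← trans (sym (count-none R (λ u → Bool.¬-not (λ Ru → none (u , Ru))))) cnt

lookup-injective : ∀ {A : Set} {xs : List A} → Unique xs → ∀ i j → lookup xs i ≡ lookup xs j → i ≡ j
lookup-injective (x∉xs ∷ _)     zero    zero    _  = refl
lookup-injective (x∉xs ∷ _)     zero    (suc j) eq = ⊥-elim (All.lookup x∉xs (∈-lookup j) eq)
lookup-injective (x∉xs ∷ _)     (suc i) zero    eq = ⊥-elim (All.lookup x∉xs (∈-lookup i) (sym eq))
lookup-injective (_    ∷ uniq) (suc i) (suc j) eq = cong suc (lookup-injective uniq i j eq)

inducedVerts-injective : (R : Fin n → Bool) (k l : Fin (count R)) →
  lookup (inducedVerts R) k ≡ lookup (inducedVerts R) l → k ≡ l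
inducedVerts-injective {n} R = lookup-injective (Unique.filter⁺ (T? ∘ R) (Unique.allFin⁺ n))

inducedVerts-sound : (R : Fin n → Bool) (k : Fin (count R)) → R (lookup (inducedVerts R) k) ≡ true
inducedVerts-sound {n} R k = Equivalence.to Bool.T-≡ (All.lookup (all-filter (T? ∘ R) (allFin n)) (∈-lookup k))

-- Determinants

Mat : ℕ → Set
Mat n = Fin n → Fin n → ℤ

minor : Mat (suc n) → Fin (suc n) → Fin (suc n) → Mat n
minor N u k i l = N (punchIn u i) (punchIn k l)

det-suc : (N : Mat (suc n)) → det (suc n) N ≡ ∑[ j < suc n ] (sign (toℕ j) * N zero j * det n (minor N zero j))
det-suc {n} N = sumFin≡sum (λ j → sign (toℕ j) * N zero j * det n (minor N zero j))

det-cong : {A B : Mat n} → (∀ i j → A i j ≡ B i j) → det n A ≡ det n B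
det-cong {zero}  A≡B = refl
det-cong {suc n} {A} {B} A≡B = begin
  det (suc n) A                                                ≡⟨ det-suc A ⟩
  ∑[ j < suc n ] (sign (toℕ j) * A zero j * det n (minor A zero j)) ≡⟨ sum-cong-≗ term ⟩
  ∑[ j < suc n ] (sign (toℕ j) * B zero j * det n (minor B zero j)) ≡⟨ det-suc B ⟨
  det (suc n) B                                                ∎
  where
  term : ∀ j → sign (toℕ j) * A zero j * det n (minor A zero j) ≡ sign (toℕ j) * B zero j * det n (minor B zero j)
  term j = cong₂ (λ a d → sign (toℕ j) * a * d) (A≡B zero j) (det-cong {A = minor A zero j} {minor B zero j} (λ i l → A≡B _ _))

sign-sq : ∀ m → sign m * sign m ≡ + 1
sign-sq zero    = refl
sign-sq (suc m) = trans (neg*neg (sign m)) (sign-sq m)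
  where
  neg*neg : ∀ a → - a * - a ≡ a * a
  neg*neg = solve-∀

∑∑-punchIn-pinch : ∀ {m} (F : Fin (suc m) → Fin m → ℤ) →
  ∑[ j < suc m ] ∑[ k < m ] F j k ≡ ∑[ j < suc m ] ∑[ k < m ] F (punchIn j k) (pinch k j)
∑∑-punchIn-pinch {zero}  F = refl
∑∑-punchIn-pinch {suc m} F = begin
  A + ∑[ j < suc m ] (F (suc j) zero + ∑[ k < m ] F (suc j) (suc k))
      ≡⟨ cong (_+_ A) (∑-distrib-+ (λ j → F (suc j) zero) (λ j → ∑[ k < m ] F (suc j) (suc k))) ⟩
  A + (B + ∑[ j < suc m ] ∑[ k < m ] F (suc j) (suc k))
      ≡⟨ cong (λ t → A + (B + t)) (∑∑-punchIn-pinch (λ j k → F (suc j) (suc k))) ⟩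
  A + (B + C)                                                        ≡⟨ exchange A B C ⟩
  B + (A + C)
      ≡⟨ cong (_+_ B) (∑-distrib-+ (F zero) (λ j → ∑[ k < m ] F (suc (punchIn j k)) (suc (pinch k j)))) ⟨
  B + ∑[ j < suc m ] (F zero j + ∑[ k < m ] F (suc (punchIn j k)) (suc (pinch k j))) ∎
  where
  A = ∑[ k < suc m ] F zero k
  B = ∑[ j < suc m ] F (suc j) zero
  C = ∑[ j < suc m ] ∑[ k < m ] F (suc (punchIn j k)) (suc (pinch k j))
  exchange : ∀ a b c → a + (b + c) ≡ b + (a + c)
  exchange = solve-∀

punchIn-pinch : ∀ {m} (j : Fin (suc m)) (k : Fin m) → punchIn (punchIn j k) (pinch k j) ≡ j
punchIn-pinch zero    zero    = refl
punchIn-pinch zero    (suc k) = refl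
punchIn-pinch (suc j) zero    = refl
punchIn-pinch (suc j) (suc k) = cong suc (punchIn-pinch j k)

punchIn-punchIn-pinch : ∀ {m} (j : Fin (suc (suc m))) (k : Fin (suc m)) (l : Fin m) →
  punchIn (punchIn j k) (punchIn (pinch k j) l) ≡ punchIn j (punchIn k l)
punchIn-punchIn-pinch zero    zero    l       = refl
punchIn-punchIn-pinch zero    (suc k) l       = refl
punchIn-punchIn-pinch (suc j) zero    l       = refl
punchIn-punchIn-pinch (suc j) (suc k) zero    = refl
punchIn-punchIn-pinch (suc j) (suc k) (suc l) = cong suc (punchIn-punchIn-pinch j k l)

sign-punchIn-pinch : ∀ {m} (j : Fin (suc m)) (k : Fin m) →
  sign (toℕ (punchIn j k)) * sign (toℕ (pinch k j)) ≡ - (sign (toℕ j) * sign (toℕ k))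
sign-punchIn-pinch zero    zero    = refl
sign-punchIn-pinch zero    (suc k) = neg-neg (sign (toℕ k))
  where
  neg-neg : ∀ a → - - a * + 1 ≡ - (+ 1 * - a)
  neg-neg = solve-∀
sign-punchIn-pinch (suc j) zero    = neg-neg (sign (toℕ j))
  where
  neg-neg : ∀ a → + 1 * a ≡ - (- a * + 1)
  neg-neg = solve-∀
sign-punchIn-pinch (suc j) (suc k) = begin
  - sj′ * - sk′       ≡⟨ neg*neg sj′ sk′ ⟩
  sj′ * sk′           ≡⟨ sign-punchIn-pinch j k ⟩
  - (sj * sk)         ≡⟨ neg*neg′ sj sk ⟩
  - (- sj * - sk)     ∎
  where
  sj = sign (toℕ j)
  sk = sign (toℕ k)
  sj′ = sign (toℕ (punchIn j k))
  sk′ = sign (toℕ (pinch k j))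
  neg*neg : ∀ a b → - a * - b ≡ a * b
  neg*neg = solve-∀
  neg*neg′ : ∀ a b → - (a * b) ≡ - (- a * - b)
  neg*neg′ = solve-∀

twoRowMinor : Mat (suc (suc n)) → Fin (suc (suc n)) → Fin (suc n) → Mat n
twoRowMinor N j k i l = N (suc (suc i)) (punchIn j (punchIn k l))

twoRowTerm : Mat (suc (suc n)) → Fin (suc (suc n)) → Fin (suc n) → ℤ
twoRowTerm {n} N j k =
  sign (toℕ j) * sign (toℕ k) * (N zero j * N (suc zero) (punchIn j k)) * det n (twoRowMinor N j k)

det-expand₂ : (N : Mat (suc (suc n))) →
  det (suc (suc n)) N ≡ ∑[ j < suc (suc n) ] ∑[ k < suc n ] twoRowTerm N j k
det-expand₂ {n} N = begin
  det (suc (suc n)) N                                                   ≡⟨ det-suc N ⟩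
  ∑[ j < suc (suc n) ] (sign (toℕ j) * N zero j * det (suc n) (minor N zero j)) ≡⟨ sum-cong-≗ expand-minor ⟩
  ∑[ j < suc (suc n) ] ∑[ k < suc n ] twoRowTerm N j k                   ∎
  where
  rearrange : ∀ sj a sk b d → sj * a * (sk * b * d) ≡ sj * sk * (a * b) * d
  rearrange = solve-∀
  expand-minor : ∀ j → sign (toℕ j) * N zero j * det (suc n) (minor N zero j) ≡ ∑[ k < suc n ] twoRowTerm N j k
  expand-minor j = begin
    c * det (suc n) (minor N zero j)   ≡⟨ cong (c *_) (det-suc (minor N zero j)) ⟩
    c * ∑[ k < suc n ] t k             ≡⟨ *-distribˡ-sum c t ⟩
    ∑[ k < suc n ] (c * t k)
      ≡⟨ sum-cong-≗ (λ k → rearrange (sign (toℕ j)) (N zero j) (sign (toℕ k)) (N (suc zero) (punchIn j k)) (det n (twoRowMinor N j k))) ⟩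
    ∑[ k < suc n ] twoRowTerm N j k    ∎
    where
    c = sign (toℕ j) * N zero j
    t : Fin (suc n) → ℤ
    t k = sign (toℕ k) * N (suc zero) (punchIn j k) * det n (twoRowMinor N j k)

swap01 : Fin (suc (suc n)) → Fin (suc (suc n))
swap01 zero          = suc zero
swap01 (suc zero)    = zero
swap01 (suc (suc i)) = suc (suc i)

-- The involution (j , k) ↦ (punchIn j k , pinch k j) on the terms of the expansion along the
-- first two rows exchanges the columns taken from these two rows.
det-swap01 : (N : Mat (suc (suc n))) → det (suc (suc n)) (N ∘ swap01) ≡ - det (suc (suc n)) N
det-swap01 {n} N = begin
  det (suc (suc n)) (N ∘ swap01)                                                        ≡⟨ det-expand₂ (N ∘ swap01) ⟩
  ∑[ j < suc (suc n) ] ∑[ k < suc n ] twoRowTerm (N ∘ swap01) j k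
      ≡⟨ ∑∑-punchIn-pinch (twoRowTerm (N ∘ swap01)) ⟩
  ∑[ j < suc (suc n) ] ∑[ k < suc n ] twoRowTerm (N ∘ swap01) (punchIn j k) (pinch k j)
      ≡⟨ sum-cong-≗ (λ j → sum-cong-≗ (paired-term j)) ⟩
  ∑[ j < suc (suc n) ] ∑[ k < suc n ] (- twoRowTerm N j k)
      ≡⟨ sum-cong-≗ (λ j → ∑-neg (twoRowTerm N j)) ⟩
  ∑[ j < suc (suc n) ] (- ∑[ k < suc n ] twoRowTerm N j k)
      ≡⟨ ∑-neg (λ j → ∑[ k < suc n ] twoRowTerm N j k) ⟩
  - ∑[ j < suc (suc n) ] ∑[ k < suc n ] twoRowTerm N j k                                 ≡⟨ cong -_ (det-expand₂ N) ⟨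
  - det (suc (suc n)) N                                                                  ∎
  where
  rearrange : ∀ s a b d → - s * (b * a) * d ≡ - (s * (a * b) * d)
  rearrange = solve-∀
  paired-term : ∀ j k → twoRowTerm (N ∘ swap01) (punchIn j k) (pinch k j) ≡ - twoRowTerm N j k
  paired-term j k = begin
    sign (toℕ (punchIn j k)) * sign (toℕ (pinch k j))
      * (N (suc zero) (punchIn j k) * N zero (punchIn (punchIn j k) (pinch k j)))
      * det n (twoRowMinor N (punchIn j k) (pinch k j))
        ≡⟨ cong₂ _*_ (cong₂ (λ σ a → σ * (N (suc zero) (punchIn j k) * N zero a))
                            (sign-punchIn-pinch j k) (punchIn-pinch j k))
                     (det-cong (λ i l → cong (N (suc (suc i))) (punchIn-punchIn-pinch j k l))) ⟩
    - (sign (toℕ j) * sign (toℕ k)) * (N (suc zero) (punchIn j k) * N zero j) * det n (twoRowMinor N j k)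
        ≡⟨ rearrange (sign (toℕ j) * sign (toℕ k)) (N zero j) (N (suc zero) (punchIn j k)) (det n (twoRowMinor N j k)) ⟩
    - twoRowTerm N j k ∎

toFront : Fin (suc n) → Fin (suc n) → Fin (suc n)
toFront u zero    = u
toFront u (suc i) = punchIn u i

det-toFront : (N : Mat (suc n)) (u : Fin (suc n)) → det (suc n) (N ∘ toFront u) ≡ sign (toℕ u) * det (suc n) N
det-toFront N zero = trans (det-cong front-zero) (sym (ℤ.*-identityˡ _))
  where
  front-zero : ∀ i j → N (toFront zero i) j ≡ N i j
  front-zero zero    j = refl
  front-zero (suc i) j = refl
det-toFront {suc n} N (suc u) = begin
  det (suc (suc n)) (N ∘ toFront (suc u))  ≡⟨ det-cong swapped ⟩
  det (suc (suc n)) (K ∘ swap01)           ≡⟨ det-swap01 K ⟩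
  - det (suc (suc n)) K                    ≡⟨ cong -_ det-K ⟩
  - (sign (toℕ u) * det (suc (suc n)) N)   ≡⟨ ℤ.neg-distribˡ-* (sign (toℕ u)) (det (suc (suc n)) N) ⟩
  - sign (toℕ u) * det (suc (suc n)) N     ∎
  where
  K : Mat (suc (suc n))
  K zero    = N zero
  K (suc i) = N (suc (toFront u i))
  swapped : ∀ i j → N (toFront (suc u) i) j ≡ K (swap01 i) j
  swapped zero          j = refl
  swapped (suc zero)    j = refl
  swapped (suc (suc i)) j = refl
  rearrange : ∀ a b c → a * (b * c) ≡ b * (a * c)
  rearrange = solve-∀
  det-K : det (suc (suc n)) K ≡ sign (toℕ u) * det (suc (suc n)) N
  det-K = begin
    det (suc (suc n)) K
      ≡⟨ det-suc K ⟩
    ∑[ j < suc (suc n) ] (sign (toℕ j) * N zero j * det (suc n) (minor N zero j ∘ toFront u))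
      ≡⟨ sum-cong-≗ (λ j → cong (_*_ (sign (toℕ j) * N zero j)) (det-toFront (minor N zero j) u)) ⟩
    ∑[ j < suc (suc n) ] (sign (toℕ j) * N zero j * (sign (toℕ u) * det (suc n) (minor N zero j)))
      ≡⟨ sum-cong-≗ (λ j → rearrange (sign (toℕ j) * N zero j) (sign (toℕ u)) (det (suc n) (minor N zero j))) ⟩
    ∑[ j < suc (suc n) ] (sign (toℕ u) * (sign (toℕ j) * N zero j * det (suc n) (minor N zero j)))
      ≡⟨ *-distribˡ-sum (sign (toℕ u)) (λ j → sign (toℕ j) * N zero j * det (suc n) (minor N zero j)) ⟨
    sign (toℕ u) * ∑[ j < suc (suc n) ] (sign (toℕ j) * N zero j * det (suc n) (minor N zero j))
      ≡⟨ cong (_*_ (sign (toℕ u))) (det-suc N) ⟨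
    sign (toℕ u) * det (suc (suc n)) N ∎

cofactor : Mat (suc n) → Fin (suc n) → Fin (suc n) → ℤ
cofactor {n} N u k = sign (toℕ u) * sign (toℕ k) * det n (minor N u k)

det-expand : (N : Mat (suc n)) (u : Fin (suc n)) → det (suc n) N ≡ ∑[ k < suc n ] (N u k * cofactor N u k)
det-expand {n} N u = begin
  det (suc n) N                                        ≡⟨ sign-cancel (sign (toℕ u)) _ (sign-sq (toℕ u)) ⟩
  sign (toℕ u) * (sign (toℕ u) * det (suc n) N)        ≡⟨ cong (_*_ (sign (toℕ u))) (det-toFront N u) ⟨
  sign (toℕ u) * det (suc n) (N ∘ toFront u)           ≡⟨ cong (_*_ (sign (toℕ u))) (det-suc (N ∘ toFront u)) ⟩
  sign (toℕ u) * ∑[ k < suc n ] (sign (toℕ k) * N u k * det n (minor N u k))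
      ≡⟨ *-distribˡ-sum (sign (toℕ u)) (λ k → sign (toℕ k) * N u k * det n (minor N u k)) ⟩
  ∑[ k < suc n ] (sign (toℕ u) * (sign (toℕ k) * N u k * det n (minor N u k)))
      ≡⟨ sum-cong-≗ (λ k → rearrange (sign (toℕ u)) (sign (toℕ k)) (N u k) (det n (minor N u k))) ⟩
  ∑[ k < suc n ] (N u k * cofactor N u k)              ∎
  where
  sign-cancel : ∀ σ d → σ * σ ≡ + 1 → d ≡ σ * (σ * d)
  sign-cancel σ d σ²≡1 = sym (trans (sym (ℤ.*-assoc σ σ d)) (trans (cong (_* d) σ²≡1) (ℤ.*-identityˡ d)))
  rearrange : ∀ su sk a d → su * (sk * a * d) ≡ a * (su * sk * d)
  rearrange = solve-∀

infixl 6 _[_]≔_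
_[_]≔_ : Mat n → Fin n → (Fin n → ℤ) → Mat n
N [ u ]≔ r = updateAt N u (const r)

[]≔-updates : (N : Mat n) (u : Fin n) (r : Fin n → ℤ) → (N [ u ]≔ r) u ≡ r
[]≔-updates N u r = updateAt-updates u N

[]≔-minimal : (N : Mat n) {u i : Fin n} (r : Fin n → ℤ) → i ≢ u → (N [ u ]≔ r) i ≡ N i
[]≔-minimal N {u} {i} r i≢u = updateAt-minimal i u N i≢u

det-setRow : (N : Mat (suc n)) (u : Fin (suc n)) (r : Fin (suc n) → ℤ) →
  det (suc n) (N [ u ]≔ r) ≡ ∑[ k < suc n ] (r k * cofactor N u k)
det-setRow N u r = trans (det-expand (N [ u ]≔ r) u) (sum-cong-≗ λ k →
  cong₂ _*_ (cong-app ([]≔-updates N u r) k)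
            (cong (_*_ (sign (toℕ u) * sign (toℕ k)))
                  (det-cong (λ i l → cong-app ([]≔-minimal N r (punchInᵢ≢i u i)) (punchIn k l)))))

self-negating⇒0 : ∀ {i : ℤ} → i ≡ - i → i ≡ + 0
self-negating⇒0 {+0}           _ = refl
self-negating⇒0 {+[1+ _ ]}     ()
self-negating⇒0 {i = -[1+ _ ]} ()

det-minors≡0 : (N : Mat (suc n)) → (∀ j → det n (minor N zero j) ≡ + 0) → det (suc n) N ≡ + 0
det-minors≡0 N minor≡0 = trans (det-suc N) (∑-zero λ j →
  trans (cong (_*_ (sign (toℕ j) * N zero j)) (minor≡0 j)) (ℤ.*-zeroʳ (sign (toℕ j) * N zero j)))

mutual
  det-equalRows : (N : Mat n) {u v : Fin n} → u ≢ v → (∀ j → N u j ≡ N v j) → det n N ≡ + 0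
  det-equalRows         N {zero}  {zero}  0≢0 _  = ⊥-elim (0≢0 refl)
  det-equalRows {suc n} N {zero}  {suc v} _   eq = det-equalRows₀ N v eq
  det-equalRows {suc n} N {suc u} {zero}  _   eq = det-equalRows₀ N u (λ j → sym (eq j))
  det-equalRows {suc n} N {suc u} {suc v} u≢v eq =
    det-minors≡0 N (λ j → det-equalRows (minor N zero j) (u≢v ∘ cong suc) (λ l → eq (punchIn j l)))

  det-equalRows₀ : (N : Mat (suc n)) (v : Fin n) → (∀ j → N zero j ≡ N (suc v) j) → det (suc n) N ≡ + 0
  det-equalRows₀ N zero eq = self-negating⇒0 (trans (det-cong swap-fixes) (det-swap01 N))
    where
    swap-fixes : ∀ i j → N i j ≡ N (swap01 i) j
    swap-fixes zero          j = eq j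
    swap-fixes (suc zero)    j = sym (eq j)
    swap-fixes (suc (suc i)) j = refl
  det-equalRows₀ {suc n} N (suc v) eq = begin
    det (suc (suc n)) N                ≡⟨ ℤ.neg-involutive _ ⟨
    - - det (suc (suc n)) N            ≡⟨ cong -_ (det-swap01 N) ⟨
    - det (suc (suc n)) (N ∘ swap01)   ≡⟨ cong -_ (det-minors≡0 (N ∘ swap01) (λ j →
                                            det-equalRows (minor (N ∘ swap01) zero j) {zero} {suc v} (λ ())
                                                          (λ l → eq (punchIn j l)))) ⟩
    + 0                                ∎

det-setRow-combination : (N : Mat n) (u : Fin n) (c : Fin n → ℤ) {r : Fin n → ℤ} →
  (∀ j → r j ≡ ∑[ v < n ] (c v * N v j)) → det n (N [ u ]≔ r) ≡ c u * det n N
det-setRow-combination {suc n} N u c {r} r≡ = begin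
  det (suc n) (N [ u ]≔ r)                                           ≡⟨ det-setRow N u r ⟩
  ∑[ k < suc n ] (r k * cof k)                                        ≡⟨ sum-cong-≗ (λ k → cong (_* cof k) (r≡ k)) ⟩
  ∑[ k < suc n ] (∑[ v < suc n ] (c v * N v k) * cof k)
      ≡⟨ sum-cong-≗ (λ k → *-distribʳ-sum (cof k) (λ v → c v * N v k)) ⟩
  ∑[ k < suc n ] ∑[ v < suc n ] (c v * N v k * cof k)                 ≡⟨ ∑-comm (λ k v → c v * N v k * cof k) ⟩
  ∑[ v < suc n ] ∑[ k < suc n ] (c v * N v k * cof k)
      ≡⟨ sum-cong-≗ (λ v → sum-cong-≗ (λ k → ℤ.*-assoc (c v) (N v k) (cof k))) ⟩
  ∑[ v < suc n ] ∑[ k < suc n ] (c v * (N v k * cof k))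
      ≡⟨ sum-cong-≗ (λ v → *-distribˡ-sum (c v) (λ k → N v k * cof k)) ⟨
  ∑[ v < suc n ] (c v * ∑[ k < suc n ] (N v k * cof k))
      ≡⟨ sum-cong-≗ (λ v → cong (_*_ (c v)) (det-setRow N u (N v))) ⟨
  ∑[ v < suc n ] (c v * det (suc n) (N [ u ]≔ N v))                   ≡⟨ sum-cong-≗ only-u-survives ⟩
  ∑[ v < suc n ] (δ u v * (c v * det (suc n) N))                      ≡⟨ ∑-δ u (λ v → c v * det (suc n) N) ⟩
  c u * det (suc n) N                                                ∎
  where
  cof = cofactor N u
  only-u-survives : ∀ v → c v * det (suc n) (N [ u ]≔ N v) ≡ δ u v * (c v * det (suc n) N)
  only-u-survives v with u ≟ v
  ... | yes refl = trans (cong (_*_ (c u)) (det-cong (λ i j → cong-app (updateAt-id-local u N refl i) j)))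
                         (sym (ℤ.*-identityˡ _))
  ... | no u≢v   = trans (cong (_*_ (c v)) (det-equalRows (N [ u ]≔ N v) u≢v (λ j →
                           trans (cong-app ([]≔-updates N u (N v)) j) (sym (cong-app ([]≔-minimal N (N v) (u≢v ∘ sym)) j)))))
                         (ℤ.*-zeroʳ (c v))

-- Since no row of X enters the new row of another row of X, the rows can be replaced one at a time.
det-combineRows : (X : Fin n → Bool) (k : ℤ) (c : Fin n → Fin n → ℤ) {M N : Mat n} →
  (∀ i → X i ≡ false → ∀ j → M i j ≡ N i j) →
  (∀ i → X i ≡ true → ∀ j → M i j ≡ ∑[ v < n ] (c i v * N v j)) →
  (∀ i v → X i ≡ true → X v ≡ true → c i v ≡ k * δ i v) →
  det n M ≡ k ^ count X * det n N
det-combineRows {n} X k c {N = N} = by-count (count X) X refl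
  where
  by-count : ∀ m (X : Fin n → Bool) {M : Mat n} → count X ≡ m →
    (∀ i → X i ≡ false → ∀ j → M i j ≡ N i j) →
    (∀ i → X i ≡ true → ∀ j → M i j ≡ ∑[ v < n ] (c i v * N v j)) →
    (∀ i v → X i ≡ true → X v ≡ true → c i v ≡ k * δ i v) →
    det n M ≡ k ^ m * det n N
  by-count m X cnt keep comb diag with any? (λ i → X i Bool.≟ true)
  by-count zero X cnt keep comb diag | no none =
    trans (det-cong (λ i → keep i (Bool.¬-not (λ Xi → none (i , Xi))))) (sym (ℤ.*-identityˡ _))
  by-count (suc m) X cnt keep comb diag | no none
    with () ← trans (sym (count-none X (λ i → Bool.¬-not (λ Xi → none (i , Xi))))) cnt
  by-count zero X cnt keep comb diag | yes (u , Xu)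
    with () ← trans (sym (count-without X Xu)) cnt
  by-count (suc m) X {M} cnt keep comb diag | yes (u , Xu) = begin
    det n M                   ≡⟨ det-cong rows ⟩
    det n (M′ [ u ]≔ M u)     ≡⟨ det-setRow-combination M′ u (c u) row-u ⟩
    c u u * det n M′          ≡⟨ cong₂ _*_ c-uu (by-count m X′ count-X′ keep′ comb′ diag′) ⟩
    k * (k ^ m * det n N)     ≡⟨ ℤ.*-assoc k (k ^ m) (det n N) ⟨
    k ^ suc m * det n N       ∎
    where
    X′ = without X u
    M′ : Mat n
    M′ i = if X′ i then M i else N i
    count-X′ : count X′ ≡ m
    count-X′ = suc-injective (trans (sym (count-without X Xu)) cnt)
    keep′ : ∀ i → X′ i ≡ false → ∀ j → M′ i j ≡ N i j
    keep′ i X′i j rewrite X′i = refl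
    comb′ : ∀ i → X′ i ≡ true → ∀ j → M′ i j ≡ ∑[ v < n ] (c i v * N v j)
    comb′ i X′i j rewrite X′i = comb i (proj₂ (without-true X u X′i)) j
    diag′ : ∀ i v → X′ i ≡ true → X′ v ≡ true → c i v ≡ k * δ i v
    diag′ i v X′i X′v = diag i v (proj₂ (without-true X u X′i)) (proj₂ (without-true X u X′v))
    c-uu : c u u ≡ k
    c-uu = trans (diag u u Xu Xu) (trans (cong (k *_) (δ-refl u)) (ℤ.*-identityʳ k))
    away-from-u : ∀ i → i ≢ u → ∀ j → M i j ≡ M′ i j
    away-from-u i i≢u j with u ≟ i
    ... | yes u≡i = ⊥-elim (i≢u (sym u≡i))
    ... | no _ with X i in Xi
    ...   | true  = refl
    ...   | false = keep i Xi j
    rows : ∀ i j → M i j ≡ (M′ [ u ]≔ M u) i j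
    rows i j with i ≟ u
    ... | yes refl = sym (cong-app ([]≔-updates M′ u (M u)) j)
    ... | no i≢u   = trans (away-from-u i i≢u j) (sym (cong-app ([]≔-minimal M′ (M u) i≢u) j))
    unused-by-u : ∀ v j → c u v * N v j ≡ c u v * M′ v j
    unused-by-u v j with X′ v in X′v
    ... | false = refl
    ... | true  = trans (cong (_* N v j) c-uv≡0) (sym (cong (_* M v j) c-uv≡0))
      where
      c-uv≡0 : c u v ≡ + 0
      c-uv≡0 = trans (diag u v Xu (proj₂ (without-true X u X′v)))
                     (trans (cong (k *_) (δ-≢ (proj₁ (without-true X u X′v)))) (ℤ.*-zeroʳ k))
    row-u : ∀ j → M u j ≡ ∑[ v < n ] (c u v * M′ v j)
    row-u j = trans (comb u Xu j) (sum-cong-≗ (λ v → unused-by-u v j))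

det-setRow-pair : (A : Mat n) (w : Fin n) {u v : Fin n} (a b : ℤ) {r : Fin n → ℤ} →
  (∀ j → r j ≡ a * A u j + b * A v j) → det n (A [ w ]≔ r) ≡ (a * δ u w + b * δ v w) * det n A
det-setRow-pair A w {u} {v} a b r≡ =
  det-setRow-combination A w (λ w′ → a * δ u w′ + b * δ v w′) (λ j → trans (r≡ j) (sym (∑-pair A u v a b j)))

-- N arises from N′ by the row operations u ↦ e_u + e_v, then v ↦ β e_u + α e_v, then u ↦ α e_u + β e_v.
det-twoRows : {N N′ : Mat n} {u v : Fin n} → u ≢ v → (α β : ℤ) →
  (∀ j → N u j ≡ α * δ u j + β * δ v j) → (∀ j → N v j ≡ β * δ u j + α * δ v j) →
  (∀ j → N′ u j ≡ δ u j) → (∀ j → N′ v j ≡ δ v j) →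
  (∀ i → i ≢ u → i ≢ v → ∀ j → N i j ≡ N′ i j) →
  det n N ≡ (α + β) * (α - β) * det n N′
det-twoRows {n} {N} {N′} {u} {v} u≢v α β N-u N-v N′-u N′-v same = begin
  det n N                         ≡⟨ det-cong N≡A₃ ⟩
  det n A₃                        ≡⟨ det-setRow-pair A₂ u (α + β) (- + 1) A₃-from-A₂ ⟩
  c₃ * det n A₂                   ≡⟨ cong (c₃ *_) (det-setRow-pair A₁ v β (α - β) A₂-from-A₁) ⟩
  c₃ * (c₂ * det n A₁)            ≡⟨ cong (λ d → c₃ * (c₂ * d)) (det-setRow-pair N′ u (+ 1) (+ 1) A₁-from-N′) ⟩
  c₃ * (c₂ * (c₁ * det n N′))     ≡⟨ coefficients (det n N′) ⟩
  (α + β) * (α - β) * det n N′    ∎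
  where
  v≢u : v ≢ u
  v≢u v≡u = u≢v (sym v≡u)
  c₁ = + 1 * δ u u + + 1 * δ v u
  c₂ = β * δ u v + (α - β) * δ v v
  c₃ = (α + β) * δ u u + - + 1 * δ v u
  coefficients : ∀ d → c₃ * (c₂ * (c₁ * d)) ≡ (α + β) * (α - β) * d
  coefficients d rewrite δ-refl u | δ-refl v | δ-≢ u≢v | δ-≢ v≢u = evaluate α β d
    where
    evaluate : ∀ a b d → ((a + b) * + 1 + - + 1 * + 0) * ((b * + 0 + (a - b) * + 1) * ((+ 1 * + 1 + + 1 * + 0) * d))
                         ≡ (a + b) * (a - b) * d
    evaluate = solve-∀
  A₁ A₂ A₃ : Mat n
  A₁ = N′ [ u ]≔ (λ j → δ u j + δ v j)
  A₂ = A₁ [ v ]≔ (λ j → β * δ u j + α * δ v j)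
  A₃ = A₂ [ u ]≔ (λ j → α * δ u j + β * δ v j)
  A₁-row-u : ∀ j → A₁ u j ≡ δ u j + δ v j
  A₁-row-u j = cong-app ([]≔-updates N′ u _) j
  A₁-row-v : ∀ j → A₁ v j ≡ δ v j
  A₁-row-v j = trans (cong-app ([]≔-minimal N′ _ v≢u) j) (N′-v j)
  A₂-row-u : ∀ j → A₂ u j ≡ δ u j + δ v j
  A₂-row-u j = trans (cong-app ([]≔-minimal A₁ _ u≢v) j) (A₁-row-u j)
  A₂-row-v : ∀ j → A₂ v j ≡ β * δ u j + α * δ v j
  A₂-row-v j = cong-app ([]≔-updates A₁ v _) j
  A₁-from-N′ : ∀ j → δ u j + δ v j ≡ + 1 * N′ u j + + 1 * N′ v j
  A₁-from-N′ j = sym (cong₂ _+_ (trans (ℤ.*-identityˡ _) (N′-u j)) (trans (ℤ.*-identityˡ _) (N′-v j)))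
  A₂-from-A₁ : ∀ j → β * δ u j + α * δ v j ≡ β * A₁ u j + (α - β) * A₁ v j
  A₂-from-A₁ j = trans (regroup α β (δ u j) (δ v j)) (sym (cong₂ (λ x y → β * x + (α - β) * y) (A₁-row-u j) (A₁-row-v j)))
    where
    regroup : ∀ α β x y → β * x + α * y ≡ β * (x + y) + (α - β) * y
    regroup = solve-∀
  A₃-from-A₂ : ∀ j → α * δ u j + β * δ v j ≡ (α + β) * A₂ u j + - + 1 * A₂ v j
  A₃-from-A₂ j = trans (regroup α β (δ u j) (δ v j)) (sym (cong₂ (λ x y → (α + β) * x + - + 1 * y) (A₂-row-u j) (A₂-row-v j)))
    where
    regroup : ∀ α β x y → α * x + β * y ≡ (α + β) * (x + y) + - + 1 * (β * x + α * y)
    regroup = solve-∀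
  N≡A₃ : ∀ i j → N i j ≡ A₃ i j
  N≡A₃ i j with i ≟ u | i ≟ v
  ... | yes refl | _        = trans (N-u j) (sym (cong-app ([]≔-updates A₂ u _) j))
  ... | no i≢u   | yes refl = trans (N-v j) (sym (trans (cong-app ([]≔-minimal A₂ _ i≢u) j) (A₂-row-v j)))
  ... | no i≢u   | no i≢v   = trans (same i i≢u i≢v j) (sym (
    trans (cong-app ([]≔-minimal A₂ _ i≢u) j) (trans (cong-app ([]≔-minimal A₁ _ i≢v) j) (cong-app ([]≔-minimal N′ _ i≢u) j))))

det-unitRow : (N : Mat (suc n)) (u : Fin (suc n)) → (∀ j → N u j ≡ δ u j) → det (suc n) N ≡ det n (minor N u u)
det-unitRow {n} N u unit = begin
  det (suc n) N                                            ≡⟨ det-expand N u ⟩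
  ∑[ k < suc n ] (N u k * cofactor N u k)                  ≡⟨ sum-cong-≗ (λ k → cong (_* cofactor N u k) (unit k)) ⟩
  ∑[ k < suc n ] (δ u k * cofactor N u k)                  ≡⟨ ∑-δ u (cofactor N u) ⟩
  sign (toℕ u) * sign (toℕ u) * det n (minor N u u)        ≡⟨ cong (_* det n (minor N u u)) (sign-sq (toℕ u)) ⟩
  + 1 * det n (minor N u u)                                ≡⟨ ℤ.*-identityˡ _ ⟩
  det n (minor N u u)                                      ∎

det-reindex : ∀ {m k} (e : m ≡ k) {A : Mat m} {B : Mat k} →
  (∀ i j → A i j ≡ B (cast e i) (cast e j)) → det m A ≡ det k B
det-reindex refl {B = B} A≡B = det-cong (λ i j → trans (A≡B i j) (cong₂ B (cast-is-id refl i) (cast-is-id refl j)))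

submatrix : Mat n → (L : List (Fin n)) → Mat (length L)
submatrix N L i j = N (lookup L i) (lookup L j)

lookup-map : ∀ {A B : Set} (g : A → B) (xs : List A) (i : Fin (length (map g xs))) →
  lookup (map g xs) i ≡ g (lookup xs (cast (length-map g xs) i))
lookup-map g (x ∷ xs) zero    = refl
lookup-map g (x ∷ xs) (suc i) = lookup-map g xs i

det-submatrix-map : ∀ {m} (N : Mat n) (g : Fin m → Fin n) (L : List (Fin m)) →
  det _ (submatrix N (map g L)) ≡ det _ (submatrix (λ i j → N (g i) (g j)) L)
det-submatrix-map N g L = det-reindex (length-map g L) (λ i j → cong₂ N (lookup-map g L i) (lookup-map g L j))

det-submatrix-allFin : (N : Mat n) → det n N ≡ det _ (submatrix N (allFin n))
det-submatrix-allFin N = det-reindex (sym (length-tabulate id))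
  (λ i j → sym (cong₂ N (lookup-tabulate id i) (lookup-tabulate id j)))

δ-punchIn : (u : Fin (suc n)) (i j : Fin n) → δ (punchIn u i) (punchIn u j) ≡ δ i j
δ-punchIn u i j with i ≟ j
... | yes refl = δ-refl (punchIn u i)
... | no i≢j   = δ-≢ (i≢j ∘ punchIn-injective u i j)

det-restrict : (N : Mat n) (R : Fin n → Bool) → (∀ u → R u ≡ false → ∀ j → N u j ≡ δ u j) →
  det n N ≡ det (count R) (submatrix N (inducedVerts R))
det-restrict {zero}  N R unit = refl
det-restrict {suc n} N R unit with any? (λ u → R u Bool.≟ false)
... | yes (u , Ru) = begin
  det (suc n) N                                                      ≡⟨ det-unitRow N u (unit u Ru) ⟩
  det n (minor N u u)
      ≡⟨ det-restrict (minor N u u) (R ∘ punchIn u) minor-unit ⟩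
  det _ (submatrix (minor N u u) (inducedVerts (R ∘ punchIn u)))
      ≡⟨ det-submatrix-map N (punchIn u) (inducedVerts (R ∘ punchIn u)) ⟨
  det _ (submatrix N (map (punchIn u) (inducedVerts (R ∘ punchIn u))))
      ≡⟨ cong (λ L → det (length L) (submatrix N L)) (inducedVerts-punchIn R u Ru) ⟨
  det _ (submatrix N (inducedVerts R))                               ∎
  where
  minor-unit : ∀ i → R (punchIn u i) ≡ false → ∀ j → minor N u u i j ≡ δ i j
  minor-unit i Ri j = trans (unit (punchIn u i) Ri (punchIn u j)) (δ-punchIn u i j)
... | no none = trans (det-submatrix-allFin N)
  (cong (λ L → det (length L) (submatrix N L)) (sym (filter-all (T? ∘ R) (universal in-R (allFin (suc n))))))
  where
  in-R : ∀ u → T (R u)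
  in-R u = Equivalence.from Bool.T-≡ (Bool.¬-not (λ Ru → none (u , Ru)))

-- Characteristic matrices of graphs

charMatrix : (Fin n → Fin n → Bool) → ℤ → Mat n
charMatrix adj x i j = (if does (i ≟ j) then x else + 0) - laplacian adj i j

charMatrix-entry : {adj : Fin n → Fin n → Bool} → IsSimpleGraph adj → (x : ℤ) (i j : Fin n) →
  charMatrix adj x i j ≡ δ i j * (x - degree adj i) + b2z (adj i j)
charMatrix-entry {adj = adj} G x i j with i ≟ j
... | yes refl rewrite IsSimpleGraph.irreflexive G i = sym (trans (ℤ.+-identityʳ _) (ℤ.*-identityˡ _))
... | no _     = off-diagonal (b2z (adj i j))
  where
  off-diagonal : ∀ a → + 0 - - a ≡ + 0 + a
  off-diagonal = solve-∀

inducedAdj-simple : {adj : Fin n → Fin n → Bool} → IsSimpleGraph adj → (R : Fin n → Bool) →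
  IsSimpleGraph (inducedAdj adj R)
inducedAdj-simple G R = record
  { symmetric   = λ i j → IsSimpleGraph.symmetric G _ _
  ; irreflexive = λ i → IsSimpleGraph.irreflexive G _
  }

-- SI-core graphs

data Side : Set where
  one two : Side

other : Side → Side
other one = two
other two = one

Sep Simp : Side → Part
Sep one  = S₁
Sep two  = S₂
Simp one = P₁
Simp two = P₂

isLab-true : ∀ ℓ {ℓ′} → isLab ℓ ℓ′ ≡ true → ℓ′ ≡ ℓ
isLab-true S₁ {S₁} _ = refl
isLab-true S₂ {S₂} _ = refl
isLab-true P₁ {P₁} _ = refl
isLab-true P₂ {P₂} _ = refl

module SICore {s p n : ℕ} {adj : Fin n → Fin n → Bool} {lab : Fin n → Part}
              (G : IsSimpleGraph adj) (core : IsSICore s p adj lab) (x : ℤ)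
              (rep : Side → Fin n) (rep-lab : ∀ σ → lab (rep σ) ≡ Sep σ) where

  open IsSimpleGraph G
  open IsSICore core

  Simp-Sep : ∀ σ {u v} → lab u ≡ Simp σ → lab v ≡ Sep σ → adj u v ≡ true
  Simp-Sep one = P₁S₁ _ _
  Simp-Sep two = P₂S₂ _ _

  Simp-far : ∀ σ {u v} → lab u ≡ Simp σ → lab v ≡ Sep (other σ) ⊎ lab v ≡ Simp (other σ) → adj u v ≡ false
  Simp-far one = P₁-far _ _
  Simp-far two = P₂-far _ _

  M : Mat n
  M = charMatrix adj x

  A : Fin n → Fin n → ℤ
  A v w = b2z (adj v w)

  𝟙 : Part → Fin n → ℤ
  𝟙 ℓ v = b2z (isLab ℓ (lab v))

  𝟙S 𝟙P : Fin n → ℤ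
  𝟙S v = b2z (isS (lab v))
  𝟙P v = b2z (isP (lab v))

  a b : ℤ
  a = x - (+ 2 * + s + + p)
  b = x - + s

  guarded : ∀ ℓ v {f g : ℤ} → (lab v ≡ ℓ → f ≡ g) → 𝟙 ℓ v * f ≡ 𝟙 ℓ v * g
  guarded ℓ v f≡g with isLab ℓ (lab v) in ℓ-v
  ... | true  = cong (+ 1 *_) (f≡g (isLab-true ℓ ℓ-v))
  ... | false = refl

  ∑-Sep : ∀ σ → ∑[ v < n ] 𝟙 (Sep σ) v ≡ + s
  ∑-Sep one = trans (sym (count-as-∑ (λ v → isLab S₁ (lab v)))) (cong +_ card-S₁)
  ∑-Sep two = trans (sym (count-as-∑ (λ v → isLab S₂ (lab v)))) (cong +_ card-S₂)

  ∑-Simp : ∀ σ → ∑[ v < n ] 𝟙 (Simp σ) v ≡ + p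
  ∑-Simp one = trans (sym (count-as-∑ (λ v → isLab P₁ (lab v)))) (cong +_ card-P₁)
  ∑-Simp two = trans (sym (count-as-∑ (λ v → isLab P₂ (lab v)))) (cong +_ card-P₂)

  𝟙S-split : ∀ σ v → 𝟙S v ≡ 𝟙 (Sep σ) v + 𝟙 (Sep (other σ)) v
  𝟙S-split σ v with lab v
  𝟙S-split one v | S₁ = refl
  𝟙S-split one v | S₂ = refl
  𝟙S-split one v | P₁ = refl
  𝟙S-split one v | P₂ = refl
  𝟙S-split two v | S₁ = refl
  𝟙S-split two v | S₂ = refl
  𝟙S-split two v | P₁ = refl
  𝟙S-split two v | P₂ = refl

  degree≡∑ : ∀ v → degree adj v ≡ ∑[ w < n ] A v w
  degree≡∑ v = sumFin≡sum (A v)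

  adj-Sep : ∀ σ {u} → lab u ≡ Sep σ → ∀ w → A u w + δ u w ≡ 𝟙S w + 𝟙 (Simp σ) w
  adj-Sep σ {u} u∈S w with u ≟ w
  adj-Sep one {u} u∈S w | yes refl rewrite irreflexive u | u∈S = refl
  adj-Sep two {u} u∈S w | yes refl rewrite irreflexive u | u∈S = refl
  ... | no u≢w with lab w in w∈
  adj-Sep one {u} u∈S w | no u≢w | S₁ rewrite S-clique u w u≢w (cong isS u∈S) (cong isS w∈) = refl
  adj-Sep one {u} u∈S w | no u≢w | S₂ rewrite S-clique u w u≢w (cong isS u∈S) (cong isS w∈) = refl
  adj-Sep one {u} u∈S w | no u≢w | P₁ rewrite symmetric u w | P₁S₁ w u w∈ u∈S = refl
  adj-Sep one {u} u∈S w | no u≢w | P₂ rewrite symmetric u w | P₂-far w u w∈ (inj₁ u∈S) = refl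
  adj-Sep two {u} u∈S w | no u≢w | S₁ rewrite S-clique u w u≢w (cong isS u∈S) (cong isS w∈) = refl
  adj-Sep two {u} u∈S w | no u≢w | S₂ rewrite S-clique u w u≢w (cong isS u∈S) (cong isS w∈) = refl
  adj-Sep two {u} u∈S w | no u≢w | P₁ rewrite symmetric u w | P₁-far w u w∈ (inj₁ u∈S) = refl
  adj-Sep two {u} u∈S w | no u≢w | P₂ rewrite symmetric u w | P₂S₂ w u w∈ u∈S = refl

  ∑-𝟙S : ∑[ v < n ] 𝟙S v ≡ + s + + s
  ∑-𝟙S = begin
    ∑[ v < n ] 𝟙S v                          ≡⟨ sum-cong-≗ (𝟙S-split one) ⟩
    ∑[ v < n ] (𝟙 S₁ v + 𝟙 S₂ v)              ≡⟨ ∑-distrib-+ (𝟙 S₁) (𝟙 S₂) ⟩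
    ∑[ v < n ] 𝟙 S₁ v + ∑[ v < n ] 𝟙 S₂ v     ≡⟨ cong₂ _+_ (∑-Sep one) (∑-Sep two) ⟩
    + s + + s                                ∎

  degree-Sep : ∀ σ {u} → lab u ≡ Sep σ → degree adj u + + 1 ≡ + 2 * + s + + p
  degree-Sep σ {u} u∈S = begin
    degree adj u + + 1                              ≡⟨ cong₂ _+_ (degree≡∑ u) (sym (∑-δ₁ u)) ⟩
    ∑[ w < n ] A u w + ∑[ w < n ] δ u w             ≡⟨ ∑-distrib-+ (A u) (δ u) ⟨
    ∑[ w < n ] (A u w + δ u w)                      ≡⟨ sum-cong-≗ (adj-Sep σ u∈S) ⟩
    ∑[ w < n ] (𝟙S w + 𝟙 (Simp σ) w)                ≡⟨ ∑-distrib-+ 𝟙S (𝟙 (Simp σ)) ⟩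
    ∑[ w < n ] 𝟙S w + ∑[ w < n ] 𝟙 (Simp σ) w       ≡⟨ cong₂ _+_ ∑-𝟙S (∑-Simp σ) ⟩
    + s + + s + + p                                 ≡⟨ double (+ s) (+ p) ⟩
    + 2 * + s + + p                                 ∎
    where
    double : ∀ s p → s + s + p ≡ + 2 * s + p
    double = solve-∀

  row-Sep : ∀ σ {u} → lab u ≡ Sep σ → ∀ j → M u j ≡ a * δ u j + 𝟙S j + 𝟙 (Simp σ) j
  row-Sep σ {u} u∈S j = begin
    M u j                                                    ≡⟨ charMatrix-entry G x u j ⟩
    δ u j * (x - degree adj u) + A u j                       ≡⟨ regroup x (degree adj u) (δ u j) (A u j) ⟩
    (x - (degree adj u + + 1)) * δ u j + (A u j + δ u j)
        ≡⟨ cong₂ (λ d r → (x - d) * δ u j + r) (degree-Sep σ u∈S) (adj-Sep σ u∈S j) ⟩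
    a * δ u j + (𝟙S j + 𝟙 (Simp σ) j)                        ≡⟨ ℤ.+-assoc (a * δ u j) (𝟙S j) (𝟙 (Simp σ) j) ⟨
    a * δ u j + 𝟙S j + 𝟙 (Simp σ) j                          ∎
    where
    regroup : ∀ x d e r → e * (x - d) + r ≡ (x - (d + + 1)) * e + (r + e)
    regroup = solve-∀

  adj-Simp : ∀ σ {v} → lab v ≡ Simp σ → ∀ w → A v w ≡ 𝟙 (Sep σ) w + 𝟙P w * A v w
  adj-Simp σ {v} v∈P w with lab w in w∈
  adj-Simp one {v} v∈P w | S₁ rewrite P₁S₁ v w v∈P w∈ = refl
  adj-Simp one {v} v∈P w | S₂ rewrite P₁-far v w v∈P (inj₁ w∈) = refl
  adj-Simp one {v} v∈P w | P₁ = sym (trans (ℤ.+-identityˡ _) (ℤ.*-identityˡ _))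
  adj-Simp one {v} v∈P w | P₂ rewrite P₁-far v w v∈P (inj₂ w∈) = refl
  adj-Simp two {v} v∈P w | S₁ rewrite P₂-far v w v∈P (inj₁ w∈) = refl
  adj-Simp two {v} v∈P w | S₂ rewrite P₂S₂ v w v∈P w∈ = refl
  adj-Simp two {v} v∈P w | P₁ rewrite P₂-far v w v∈P (inj₂ w∈) = refl
  adj-Simp two {v} v∈P w | P₂ = sym (trans (ℤ.+-identityˡ _) (ℤ.*-identityˡ _))

  degree-Simp : ∀ σ {v} → lab v ≡ Simp σ → degree adj v ≡ + s + ∑[ w < n ] (𝟙P w * A v w)
  degree-Simp σ {v} v∈P = begin
    degree adj v                                          ≡⟨ degree≡∑ v ⟩
    ∑[ w < n ] A v w                                      ≡⟨ sum-cong-≗ (adj-Simp σ v∈P) ⟩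
    ∑[ w < n ] (𝟙 (Sep σ) w + 𝟙P w * A v w)               ≡⟨ ∑-distrib-+ (𝟙 (Sep σ)) (λ w → 𝟙P w * A v w) ⟩
    ∑[ w < n ] 𝟙 (Sep σ) w + ∑[ w < n ] (𝟙P w * A v w)    ≡⟨ cong (_+ _) (∑-Sep σ) ⟩
    + s + ∑[ w < n ] (𝟙P w * A v w)                       ∎

  ∑-adj-Simp-Sep : ∀ σ {j} → lab j ≡ Sep σ → ∑[ v < n ] (𝟙 (Simp σ) v * A v j) ≡ + p
  ∑-adj-Simp-Sep σ {j} j∈S = trans (sum-cong-≗ λ v →
    trans (guarded (Simp σ) v (λ v∈P → cong b2z (Simp-Sep σ v∈P j∈S))) (ℤ.*-identityʳ _)) (∑-Simp σ)

  ∑-adj-Simp-far : ∀ σ {j} → lab j ≡ Sep (other σ) ⊎ lab j ≡ Simp (other σ) → ∑[ v < n ] (𝟙 (Simp σ) v * A v j) ≡ + 0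
  ∑-adj-Simp-far σ {j} far = ∑-zero λ v →
    trans (guarded (Simp σ) v (λ v∈P → cong b2z (Simp-far σ v∈P far))) (ℤ.*-zeroʳ (𝟙 (Simp σ) v))

  adj-Simp-sym : ∀ σ {j} → lab j ≡ Simp σ → ∀ v → 𝟙 (Simp σ) v * A v j ≡ 𝟙P v * A j v
  adj-Simp-sym σ {j} j∈P v with lab v in v∈
  adj-Simp-sym one {j} j∈P v | S₁ = refl
  adj-Simp-sym one {j} j∈P v | S₂ = refl
  adj-Simp-sym one {j} j∈P v | P₁ = cong (λ e → + 1 * b2z e) (symmetric v j)
  adj-Simp-sym one {j} j∈P v | P₂ rewrite P₁-far j v j∈P (inj₂ v∈) = refl
  adj-Simp-sym two {j} j∈P v | S₁ = refl
  adj-Simp-sym two {j} j∈P v | S₂ = refl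
  adj-Simp-sym two {j} j∈P v | P₁ rewrite P₂-far j v j∈P (inj₂ v∈) = refl
  adj-Simp-sym two {j} j∈P v | P₂ = cong (λ e → + 1 * b2z e) (symmetric v j)

  colSum-on-Simp : ∀ σ {j} → lab j ≡ Simp σ →
    + 1 * (x - degree adj j) + ∑[ v < n ] (𝟙 (Simp σ) v * A v j) ≡ + p * + 0 + b * + 1
  colSum-on-Simp σ {j} j∈P = begin
    + 1 * (x - degree adj j) + ∑[ v < n ] (𝟙 (Simp σ) v * A v j)
        ≡⟨ cong₂ (λ d t → + 1 * (x - d) + t) (degree-Simp σ j∈P) (sum-cong-≗ (adj-Simp-sym σ j∈P)) ⟩
    + 1 * (x - (+ s + h)) + h                                      ≡⟨ cancel x (+ s) (+ p) h ⟩
    + p * + 0 + b * + 1                                            ∎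
    where
    h = ∑[ w < n ] (𝟙P w * A j w)
    cancel : ∀ x s p h → + 1 * (x - (s + h)) + h ≡ p * + 0 + (x - s) * + 1
    cancel = solve-∀

  coeffs-Sep : ∀ p b → p ≡ p * + 1 + b * + 0
  coeffs-Sep = solve-∀
  coeffs-none : ∀ p b → + 0 ≡ p * + 0 + b * + 0
  coeffs-none = solve-∀

  colSum-by-label : ∀ σ j → 𝟙 (Simp σ) j * (x - degree adj j) + ∑[ v < n ] (𝟙 (Simp σ) v * A v j)
                   ≡ + p * 𝟙 (Sep σ) j + b * 𝟙 (Simp σ) j
  colSum-by-label σ j with lab j in j∈
  colSum-by-label one j | S₁ = trans (ℤ.+-identityˡ _) (trans (∑-adj-Simp-Sep one j∈) (coeffs-Sep (+ p) b))
  colSum-by-label one j | S₂ = trans (ℤ.+-identityˡ _) (trans (∑-adj-Simp-far one (inj₁ j∈)) (coeffs-none (+ p) b))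
  colSum-by-label one j | P₁ = colSum-on-Simp one j∈
  colSum-by-label one j | P₂ = trans (ℤ.+-identityˡ _) (trans (∑-adj-Simp-far one (inj₂ j∈)) (coeffs-none (+ p) b))
  colSum-by-label two j | S₁ = trans (ℤ.+-identityˡ _) (trans (∑-adj-Simp-far two (inj₁ j∈)) (coeffs-none (+ p) b))
  colSum-by-label two j | S₂ = trans (ℤ.+-identityˡ _) (trans (∑-adj-Simp-Sep two j∈) (coeffs-Sep (+ p) b))
  colSum-by-label two j | P₁ = trans (ℤ.+-identityˡ _) (trans (∑-adj-Simp-far two (inj₂ j∈)) (coeffs-none (+ p) b))
  colSum-by-label two j | P₂ = colSum-on-Simp two j∈

  colSum-Simp : ∀ σ j → ∑[ v < n ] (𝟙 (Simp σ) v * M v j) ≡ + p * 𝟙 (Sep σ) j + b * 𝟙 (Simp σ) j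
  colSum-Simp σ j = begin
    ∑[ v < n ] (𝟙 (Simp σ) v * M v j)
      ≡⟨ sum-cong-≗ (λ v → trans (cong (𝟙 (Simp σ) v *_) (charMatrix-entry G x v j)) (split v)) ⟩
    ∑[ v < n ] (δ j v * (𝟙 (Simp σ) v * (x - degree adj v)) + 𝟙 (Simp σ) v * A v j)
      ≡⟨ ∑-distrib-+ (λ v → δ j v * (𝟙 (Simp σ) v * (x - degree adj v))) (λ v → 𝟙 (Simp σ) v * A v j) ⟩
    ∑[ v < n ] (δ j v * (𝟙 (Simp σ) v * (x - degree adj v))) + ∑[ v < n ] (𝟙 (Simp σ) v * A v j)
      ≡⟨ cong (_+ ∑[ v < n ] (𝟙 (Simp σ) v * A v j)) (∑-δ j (λ v → 𝟙 (Simp σ) v * (x - degree adj v))) ⟩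
    𝟙 (Simp σ) j * (x - degree adj j) + ∑[ v < n ] (𝟙 (Simp σ) v * A v j)
      ≡⟨ colSum-by-label σ j ⟩
    + p * 𝟙 (Sep σ) j + b * 𝟙 (Simp σ) j ∎
    where
    distribute : ∀ i d y r → i * (d * y + r) ≡ d * (i * y) + i * r
    distribute = solve-∀
    split : ∀ v → 𝟙 (Simp σ) v * (δ v j * (x - degree adj v) + A v j)
                  ≡ δ j v * (𝟙 (Simp σ) v * (x - degree adj v)) + 𝟙 (Simp σ) v * A v j
    split v = trans (distribute (𝟙 (Simp σ) v) (δ v j) (x - degree adj v) (A v j))
                    (cong (λ d → d * (𝟙 (Simp σ) v * (x - degree adj v)) + 𝟙 (Simp σ) v * A v j) (δ-sym v j))

  isS-Sep : ∀ σ → isS (Sep σ) ≡ true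
  isS-Sep one = refl
  isS-Sep two = refl

  isS-Simp : ∀ σ → isS (Simp σ) ≡ false
  isS-Simp one = refl
  isS-Simp two = refl

  isP-Simp : ∀ σ → isP (Simp σ) ≡ true
  isP-Simp one = refl
  isP-Simp two = refl

  rep-distinct : rep one ≢ rep two
  rep-distinct r₁≡r₂ with () ← trans (sym (rep-lab one)) (trans (cong lab r₁≡r₂) (rep-lab two))

  notRep-separator : ∀ {σ i} → lab i ≡ Sep σ → rep σ ≢ i → ∀ τ → rep τ ≢ i
  notRep-separator {one} i∈ r≢i one = r≢i
  notRep-separator {two} i∈ r≢i two = r≢i
  notRep-separator {one} i∈ r≢i two refl with () ← trans (sym i∈) (rep-lab two)
  notRep-separator {two} i∈ r≢i one refl with () ← trans (sym i∈) (rep-lab one)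

  notRep-simplicial : ∀ {σ i} → lab i ≡ Simp σ → ∀ τ → rep τ ≢ i
  notRep-simplicial {one} i∈ one refl with () ← trans (sym i∈) (rep-lab one)
  notRep-simplicial {one} i∈ two refl with () ← trans (sym i∈) (rep-lab two)
  notRep-simplicial {two} i∈ one refl with () ← trans (sym i∈) (rep-lab one)
  notRep-simplicial {two} i∈ two refl with () ← trans (sym i∈) (rep-lab two)

  data RowKind (i : Fin n) : Set where
    representative : ∀ σ → rep σ ≡ i → RowKind i
    separator      : ∀ σ → lab i ≡ Sep σ → rep σ ≢ i → RowKind i
    simplicial     : ∀ σ → lab i ≡ Simp σ → RowKind i

  rowKind : ∀ i → RowKind i
  rowKind i with lab i in i∈ | rep one ≟ i | rep two ≟ i
  ... | S₁ | yes r | _     = representative one r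
  ... | S₁ | no r  | _     = separator one i∈ r
  ... | S₂ | _     | yes r = representative two r
  ... | S₂ | _     | no r  = separator two i∈ r
  ... | P₁ | _     | _     = simplicial one i∈
  ... | P₂ | _     | _     = simplicial two i∈

  sepOf : Fin n → Side
  sepOf i = if isLab S₁ (lab i) then one else two

  sepOf-Sep : ∀ σ {i} → lab i ≡ Sep σ → sepOf i ≡ σ
  sepOf-Sep one i∈ rewrite i∈ = refl
  sepOf-Sep two i∈ rewrite i∈ = refl

  isRep isSepNonRep : Fin n → Bool
  isRep i = does (rep one ≟ i) ∨ does (rep two ≟ i)
  isSepNonRep i = isS (lab i) ∧ not (isRep i)

  isRep-rep : ∀ σ → isRep (rep σ) ≡ true
  isRep-rep one rewrite dec-true (rep one ≟ rep one) refl = refl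
  isRep-rep two = trans (cong (does (rep one ≟ rep two) ∨_) (dec-true (rep two ≟ rep two) refl)) (Bool.∨-zeroʳ _)

  isRep-notRep : ∀ {i} → (∀ τ → rep τ ≢ i) → isRep i ≡ false
  isRep-notRep {i} notRep rewrite dec-false (rep one ≟ i) (notRep one) | dec-false (rep two ≟ i) (notRep two) = refl

  isSepNonRep-rep : ∀ σ → isSepNonRep (rep σ) ≡ false
  isSepNonRep-rep σ rewrite isRep-rep σ = Bool.∧-zeroʳ _

  isSepNonRep-separator : ∀ {σ i} → lab i ≡ Sep σ → rep σ ≢ i → isSepNonRep i ≡ true
  isSepNonRep-separator {σ} i∈ r≢i rewrite isRep-notRep (notRep-separator i∈ r≢i) | i∈ | isS-Sep σ = refl

  isSepNonRep-simplicial : ∀ {σ i} → lab i ≡ Simp σ → isSepNonRep i ≡ false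
  isSepNonRep-simplicial {σ} i∈ rewrite i∈ | isS-Simp σ = refl

  isSepNonRep⇒notRep : ∀ {i} → isSepNonRep i ≡ true → ∀ τ → rep τ ≢ i
  isSepNonRep⇒notRep i∈ τ refl with () ← trans (sym (isSepNonRep-rep τ)) i∈

  withSepRows : (Side → Fin n → ℤ) → (Fin n → Fin n → ℤ) → Mat n
  withSepRows r t i =
    if does (rep one ≟ i) then r one
    else if does (rep two ≟ i) then r two
    else if isS (lab i) then t i
    else M i

  withSepRows-rep : ∀ r t σ → withSepRows r t (rep σ) ≡ r σ
  withSepRows-rep r t one rewrite dec-true (rep one ≟ rep one) refl = refl
  withSepRows-rep r t two rewrite dec-false (rep one ≟ rep two) rep-distinct | dec-true (rep two ≟ rep two) refl = refl

  withSepRows-notRep : ∀ r t {i} → (∀ τ → rep τ ≢ i) → withSepRows r t i ≡ (if isS (lab i) then t i else M i)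
  withSepRows-notRep r t {i} notRep rewrite dec-false (rep one ≟ i) (notRep one) | dec-false (rep two ≟ i) (notRep two) = refl

  withSepRows-separator : ∀ r t {σ i} → lab i ≡ Sep σ → rep σ ≢ i → withSepRows r t i ≡ t i
  withSepRows-separator r t {σ} {i} i∈ r≢i = trans (withSepRows-notRep r t (notRep-separator i∈ r≢i))
    (cong (λ c → if c then t i else M i) (trans (cong isS i∈) (isS-Sep σ)))

  withSepRows-simplicial : ∀ r t {σ i} → lab i ≡ Simp σ → withSepRows r t i ≡ M i
  withSepRows-simplicial r t {σ} {i} i∈ = trans (withSepRows-notRep r t (notRep-simplicial i∈))
    (cong (λ c → if c then t i else M i) (trans (cong isS i∈) (isS-Simp σ)))

  diffRow : Fin n → Fin n → ℤ
  diffRow i j = δ i j - δ (rep (sepOf i)) j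

  sepCoeff : ℤ → Fin n → Fin n → ℤ
  sepCoeff k i v = k * δ i v + + 1 * δ (rep (sepOf i)) v

  sepCoeff-diag : ∀ k i v → isSepNonRep v ≡ true → sepCoeff k i v ≡ k * δ i v
  sepCoeff-diag k i v v∈ =
    trans (cong (λ d → k * δ i v + + 1 * d) (δ-≢ (isSepNonRep⇒notRep v∈ (sepOf i)))) (ℤ.+-identityʳ _)

  repRowM repRowδ : Side → Fin n → ℤ
  repRowM σ = M (rep σ)
  repRowδ σ = δ (rep σ)

  M₁ M₃ M₄ : Mat n
  M₁ = withSepRows repRowM diffRow
  M₃ = withSepRows repRowδ diffRow
  M₄ = withSepRows repRowδ δ

  det-M≡M₁ : det n M ≡ a ^ count isSepNonRep * det n M₁
  det-M≡M₁ = det-combineRows isSepNonRep a (sepCoeff a) keep comb (λ i v _ v∈ → sepCoeff-diag a i v v∈)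
    where
    keep : ∀ i → isSepNonRep i ≡ false → ∀ j → M i j ≡ M₁ i j
    keep i i∉ j with rowKind i
    ... | representative σ refl = sym (cong-app (withSepRows-rep repRowM diffRow σ) j)
    ... | separator σ i∈ r≢i with () ← trans (sym (isSepNonRep-separator i∈ r≢i)) i∉
    ... | simplicial σ i∈ = sym (cong-app (withSepRows-simplicial repRowM diffRow i∈) j)
    cancel : ∀ a d e S P → a * (d - e) + + 1 * (a * e + S + P) ≡ a * d + S + P
    cancel = solve-∀
    comb : ∀ i → isSepNonRep i ≡ true → ∀ j → M i j ≡ ∑[ v < n ] (sepCoeff a i v * M₁ v j)
    comb i i∈X j with rowKind i
    ... | representative σ refl with () ← trans (sym (isSepNonRep-rep σ)) i∈X
    ... | simplicial σ i∈ with () ← trans (sym (isSepNonRep-simplicial i∈)) i∈X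
    ... | separator σ i∈ r≢i = sym (begin
      ∑[ v < n ] (sepCoeff a i v * M₁ v j)
        ≡⟨ ∑-pair M₁ i (rep (sepOf i)) a (+ 1) j ⟩
      a * M₁ i j + + 1 * M₁ (rep (sepOf i)) j
        ≡⟨ cong₂ (λ t u → a * t + + 1 * u) (cong-app (withSepRows-separator repRowM diffRow i∈ r≢i) j)
                                           (cong-app (withSepRows-rep repRowM diffRow (sepOf i)) j) ⟩
      a * (δ i j - δ (rep (sepOf i)) j) + + 1 * M (rep (sepOf i)) j
        ≡⟨ cong (λ τ → a * (δ i j - δ (rep τ) j) + + 1 * M (rep τ) j) (sepOf-Sep σ i∈) ⟩
      a * (δ i j - δ (rep σ) j) + + 1 * M (rep σ) j
        ≡⟨ cong (λ t → a * (δ i j - δ (rep σ) j) + + 1 * t) (row-Sep σ (rep-lab σ) j) ⟩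
      a * (δ i j - δ (rep σ) j) + + 1 * (a * δ (rep σ) j + 𝟙S j + 𝟙 (Simp σ) j)
        ≡⟨ cancel a (δ i j) (δ (rep σ) j) (𝟙S j) (𝟙 (Simp σ) j) ⟩
      a * δ i j + 𝟙S j + 𝟙 (Simp σ) j
        ≡⟨ row-Sep σ i∈ j ⟨
      M i j ∎)

  𝟙X : Side → Fin n → ℤ
  𝟙X σ v = 𝟙 (Sep σ) v - δ (rep σ) v

  𝟙X-rep : ∀ σ τ → 𝟙X σ (rep τ) ≡ + 0
  𝟙X-rep σ τ rewrite rep-lab τ with σ | τ
  ... | one | one = cong (λ d → + 1 - d) (δ-refl (rep one))
  ... | two | two = cong (λ d → + 1 - d) (δ-refl (rep two))
  ... | one | two = cong (λ d → + 0 - d) (δ-≢ rep-distinct)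
  ... | two | one = cong (λ d → + 0 - d) (δ-≢ (rep-distinct ∘ sym))

  𝟙-Sep-rep : ∀ τ → 𝟙 (Sep τ) (rep τ) ≡ + 1
  𝟙-Sep-rep one rewrite rep-lab one = refl
  𝟙-Sep-rep two rewrite rep-lab two = refl

  𝟙-Simp-rep : ∀ σ τ → 𝟙 (Simp σ) (rep τ) ≡ + 0
  𝟙-Simp-rep σ τ rewrite rep-lab τ with σ | τ
  ... | one | one = refl
  ... | one | two = refl
  ... | two | one = refl
  ... | two | two = refl

  guardedX : ∀ τ v {f g : ℤ} → (lab v ≡ Sep τ → rep τ ≢ v → f ≡ g) → 𝟙X τ v * f ≡ 𝟙X τ v * g
  guardedX τ v {f} {g} f≡g with rep τ ≟ v
  ... | yes refl = trans (cong (λ e → (e - + 1) * f) (𝟙-Sep-rep τ)) (sym (cong (λ e → (e - + 1) * g) (𝟙-Sep-rep τ)))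
  ... | no r≢v   = trans (cong (_* f) (ℤ.+-identityʳ (𝟙 (Sep τ) v)))
                  (trans (guarded (Sep τ) v (λ v∈ → f≡g v∈ r≢v)) (sym (cong (_* g) (ℤ.+-identityʳ (𝟙 (Sep τ) v)))))

  ∑-𝟙X : ∀ τ → ∑[ v < n ] 𝟙X τ v ≡ + s - + 1
  ∑-𝟙X τ = begin
    ∑[ v < n ] (𝟙 (Sep τ) v - δ (rep τ) v)                    ≡⟨ ∑-distrib-+ (𝟙 (Sep τ)) (λ v → - δ (rep τ) v) ⟩
    ∑[ v < n ] 𝟙 (Sep τ) v + ∑[ v < n ] (- δ (rep τ) v)
        ≡⟨ cong₂ _+_ (∑-Sep τ) (trans (∑-neg (δ (rep τ))) (cong -_ (∑-δ₁ (rep τ)))) ⟩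
    + s - + 1                                                ∎

  ∑-𝟙X-M₁ : ∀ τ j → ∑[ v < n ] (𝟙X τ v * M₁ v j) ≡ 𝟙 (Sep τ) j - + s * δ (rep τ) j
  ∑-𝟙X-M₁ τ j = begin
    ∑[ v < n ] (𝟙X τ v * M₁ v j)
      ≡⟨ sum-cong-≗ (λ v → guardedX τ v (λ v∈ r≢v → diff-row v∈ r≢v)) ⟩
    ∑[ v < n ] (𝟙X τ v * (δ v j - δ (rep τ) j))
        ≡⟨ sum-cong-≗ (λ v → trans (spread (𝟙X τ v) (δ v j) (δ (rep τ) j))
                                 (cong (λ d → d * 𝟙X τ v + - δ (rep τ) j * 𝟙X τ v) (δ-sym v j))) ⟩
    ∑[ v < n ] (δ j v * 𝟙X τ v + - δ (rep τ) j * 𝟙X τ v)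
      ≡⟨ ∑-distrib-+ (λ v → δ j v * 𝟙X τ v) (λ v → - δ (rep τ) j * 𝟙X τ v) ⟩
    ∑[ v < n ] (δ j v * 𝟙X τ v) + ∑[ v < n ] (- δ (rep τ) j * 𝟙X τ v)
        ≡⟨ cong₂ _+_ (∑-δ j (𝟙X τ)) (trans (sym (*-distribˡ-sum (- δ (rep τ) j) (𝟙X τ))) (cong (- δ (rep τ) j *_) (∑-𝟙X τ))) ⟩
    𝟙 (Sep τ) j - δ (rep τ) j + - δ (rep τ) j * (+ s - + 1)
      ≡⟨ collect (𝟙 (Sep τ) j) (δ (rep τ) j) (+ s) ⟩
    𝟙 (Sep τ) j - + s * δ (rep τ) j ∎
    where
    collect : ∀ S e s → S - e + - e * (s - + 1) ≡ S - s * e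
    collect = solve-∀
    spread : ∀ e d f → e * (d - f) ≡ d * e + - f * e
    spread = solve-∀
    diff-row : ∀ {v} → lab v ≡ Sep τ → rep τ ≢ v → M₁ v j ≡ δ v j - δ (rep τ) j
    diff-row {v} v∈ r≢v = trans (cong-app (withSepRows-separator repRowM diffRow v∈ r≢v) j)
                                (cong (λ σ → δ v j - δ (rep σ) j) (sepOf-Sep τ v∈))

  -- Rows u₁, u₂ of M₂ form the block ((κ , β) , (β , κ)), with κ + β = x(x − s − p) and
  -- κ − β = x² − (3s + p)x + 2s².
  κ β : ℤ
  κ = b * a + + s * (b - + p)
  β = + s * b

  -- Subtracting the rows of P_σ clears P_σ; the rows e_v − e_{u_τ}, v ∈ S_τ ∖ {u_τ}, then clear S.
  elim : Side → Fin n → ℤ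
  elim σ v = - + 1 * 𝟙 (Simp σ) v + - (b - + p) * 𝟙X σ v + - b * 𝟙X (other σ) v

  pairRow : Side → Fin n → ℤ
  pairRow σ j = κ * δ (rep σ) j + β * δ (rep (other σ)) j

  M₂ : Mat n
  M₂ = withSepRows pairRow diffRow

  ∑-Simp-M₁ : ∀ σ j → ∑[ v < n ] (𝟙 (Simp σ) v * M₁ v j) ≡ + p * 𝟙 (Sep σ) j + b * 𝟙 (Simp σ) j
  ∑-Simp-M₁ σ j = trans (sum-cong-≗ (λ v → guarded (Simp σ) v (λ v∈ → cong-app (withSepRows-simplicial repRowM diffRow v∈) j)))
                      (colSum-Simp σ j)

  eliminate : ∀ σ j → b * M (rep σ) j + ∑[ v < n ] (elim σ v * M₁ v j) ≡ pairRow σ j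
  eliminate σ j = begin
    b * M (rep σ) j + ∑[ v < n ] (elim σ v * M₁ v j)
      ≡⟨ cong₂ _+_ (cong (b *_) row-u)
                   (trans (sum-cong-≗ spread-v) (∑-combination₃ (- + 1) (- (b - + p)) (- b) P-part X-part Xo-part)) ⟩
    b * (a * d + (S + S′) + P) + (- + 1 * sum P-part + - (b - + p) * sum X-part + - b * sum Xo-part)
      ≡⟨ cong (λ t → b * (a * d + (S + S′) + P) + t)
              (cong₂ _+_ (cong₂ _+_ (cong (- + 1 *_) (∑-Simp-M₁ σ j)) (cong (- (b - + p) *_) (∑-𝟙X-M₁ σ j)))
                         (cong (- b *_) (∑-𝟙X-M₁ (other σ) j))) ⟩
    b * (a * d + (S + S′) + P) + (- + 1 * (+ p * S + b * P) + - (b - + p) * (S - + s * d) + - b * (S′ - + s * d′))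
      ≡⟨ collect a b (+ s) (+ p) d d′ S S′ P ⟩
    pairRow σ j ∎
    where
    d = δ (rep σ) j
    d′ = δ (rep (other σ)) j
    S = 𝟙 (Sep σ) j
    S′ = 𝟙 (Sep (other σ)) j
    P = 𝟙 (Simp σ) j
    P-part X-part Xo-part : Fin n → ℤ
    P-part v = 𝟙 (Simp σ) v * M₁ v j
    X-part v = 𝟙X σ v * M₁ v j
    Xo-part v = 𝟙X (other σ) v * M₁ v j
    row-u : M (rep σ) j ≡ a * d + (S + S′) + P
    row-u = trans (row-Sep σ (rep-lab σ) j) (cong (λ t → a * d + t + P) (𝟙S-split σ j))
    spread : ∀ c₁ c₂ c₃ f g h m → (c₁ * f + c₂ * g + c₃ * h) * m ≡ c₁ * (f * m) + c₂ * (g * m) + c₃ * (h * m)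
    spread = solve-∀
    spread-v : ∀ v → elim σ v * M₁ v j ≡ - + 1 * P-part v + - (b - + p) * X-part v + - b * Xo-part v
    spread-v v = spread (- + 1) (- (b - + p)) (- b) (𝟙 (Simp σ) v) (𝟙X σ v) (𝟙X (other σ) v) (M₁ v j)
    collect : ∀ a b s p d d′ S S′ P →
      b * (a * d + (S + S′) + P) + (- + 1 * (p * S + b * P) + - (b - p) * (S - s * d) + - b * (S′ - s * d′))
        ≡ (b * a + s * (b - p)) * d + s * b * d′
    collect = solve-∀

  elim-rep : ∀ σ τ → elim σ (rep τ) ≡ + 0
  elim-rep σ τ rewrite 𝟙-Simp-rep σ τ | 𝟙X-rep σ τ | 𝟙X-rep (other σ) τ = vanish (- (b - + p)) (- b)
    where
    vanish : ∀ c₂ c₃ → - + 1 * + 0 + c₂ * + 0 + c₃ * + 0 ≡ + 0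
    vanish = solve-∀

  isRep⇒rep : ∀ {v} → isRep v ≡ true → Σ Side (λ τ → rep τ ≡ v)
  isRep⇒rep {v} v∈ with rowKind v
  ... | representative τ r = τ , r
  ... | separator σ v∈S r≢v with () ← trans (sym (isRep-notRep (notRep-separator v∈S r≢v))) v∈
  ... | simplicial σ v∈P with () ← trans (sym (isRep-notRep (notRep-simplicial v∈P))) v∈

  repCoeff : Fin n → Fin n → ℤ
  repCoeff i v = b * δ i v + elim (sepOf i) v

  det-M₂≡M₁ : det n M₂ ≡ b ^ count isRep * det n M₁
  det-M₂≡M₁ = det-combineRows isRep b repCoeff keep comb diag
    where
    keep : ∀ i → isRep i ≡ false → ∀ j → M₂ i j ≡ M₁ i j
    keep i i∉ j with rowKind i
    ... | representative σ refl with () ← trans (sym (isRep-rep σ)) i∉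
    ... | separator σ i∈ r≢i = trans (cong-app (withSepRows-separator pairRow diffRow i∈ r≢i) j)
                                     (sym (cong-app (withSepRows-separator repRowM diffRow i∈ r≢i) j))
    ... | simplicial σ i∈ = trans (cong-app (withSepRows-simplicial pairRow diffRow i∈) j)
                                  (sym (cong-app (withSepRows-simplicial repRowM diffRow i∈) j))
    distribute : ∀ b d e m → (b * d + e) * m ≡ d * (b * m) + e * m
    distribute = solve-∀
    comb : ∀ i → isRep i ≡ true → ∀ j → M₂ i j ≡ ∑[ v < n ] (repCoeff i v * M₁ v j)
    comb i i∈ j with rowKind i
    ... | separator σ i∈S r≢i with () ← trans (sym (isRep-notRep (notRep-separator i∈S r≢i))) i∈
    ... | simplicial σ i∈P with () ← trans (sym (isRep-notRep (notRep-simplicial i∈P))) i∈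
    ... | representative σ refl = begin
      M₂ (rep σ) j                                              ≡⟨ cong-app (withSepRows-rep pairRow diffRow σ) j ⟩
      pairRow σ j                                               ≡⟨ eliminate σ j ⟨
      b * M (rep σ) j + ∑[ v < n ] (elim σ v * M₁ v j)
        ≡⟨ cong₂ (λ t τ → b * t + ∑[ v < n ] (elim τ v * M₁ v j)) (cong-app (withSepRows-rep repRowM diffRow σ) j)
                                                                   (sepOf-Sep σ (rep-lab σ)) ⟨
      b * M₁ (rep σ) j + ∑[ v < n ] (elim (sepOf (rep σ)) v * M₁ v j)
        ≡⟨ cong (_+ ∑[ v < n ] (elim (sepOf (rep σ)) v * M₁ v j)) (∑-δ (rep σ) (λ v → b * M₁ v j)) ⟨
      ∑[ v < n ] (δ (rep σ) v * (b * M₁ v j)) + ∑[ v < n ] (elim (sepOf (rep σ)) v * M₁ v j)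
        ≡⟨ ∑-distrib-+ (λ v → δ (rep σ) v * (b * M₁ v j)) (λ v → elim (sepOf (rep σ)) v * M₁ v j) ⟨
      ∑[ v < n ] (δ (rep σ) v * (b * M₁ v j) + elim (sepOf (rep σ)) v * M₁ v j)
        ≡⟨ sum-cong-≗ (λ v → distribute b (δ (rep σ) v) (elim (sepOf (rep σ)) v) (M₁ v j)) ⟨
      ∑[ v < n ] (repCoeff (rep σ) v * M₁ v j)                  ∎
    diag : ∀ i v → isRep i ≡ true → isRep v ≡ true → repCoeff i v ≡ b * δ i v
    diag i v _ v∈ with isRep⇒rep v∈
    ... | τ , refl = trans (cong (_+_ (b * δ i (rep τ))) (elim-rep (sepOf i) τ)) (ℤ.+-identityʳ _)

  det-M₂≡M₃ : det n M₂ ≡ (κ + β) * (κ - β) * det n M₃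
  det-M₂≡M₃ = det-twoRows rep-distinct κ β
    (cong-app (withSepRows-rep pairRow diffRow one))
    (λ j → trans (cong-app (withSepRows-rep pairRow diffRow two) j) (ℤ.+-comm (κ * δ (rep two) j) (β * δ (rep one) j)))
    (cong-app (withSepRows-rep repRowδ diffRow one))
    (cong-app (withSepRows-rep repRowδ diffRow two))
    same
    where
    same : ∀ i → i ≢ rep one → i ≢ rep two → ∀ j → M₂ i j ≡ M₃ i j
    same i i≢r₁ i≢r₂ j = trans (cong-app (withSepRows-notRep pairRow diffRow notRep) j)
                               (sym (cong-app (withSepRows-notRep repRowδ diffRow notRep) j))
      where
      notRep : ∀ τ → rep τ ≢ i
      notRep one r≡i = i≢r₁ (sym r≡i)
      notRep two r≡i = i≢r₂ (sym r≡i)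

  det-M₄≡M₃ : det n M₄ ≡ (+ 1) ^ count isSepNonRep * det n M₃
  det-M₄≡M₃ = det-combineRows isSepNonRep (+ 1) (sepCoeff (+ 1)) keep comb (λ i v _ v∈ → sepCoeff-diag (+ 1) i v v∈)
    where
    keep : ∀ i → isSepNonRep i ≡ false → ∀ j → M₄ i j ≡ M₃ i j
    keep i i∉ j with rowKind i
    ... | representative σ refl = trans (cong-app (withSepRows-rep repRowδ δ σ) j)
                                        (sym (cong-app (withSepRows-rep repRowδ diffRow σ) j))
    ... | separator σ i∈ r≢i with () ← trans (sym (isSepNonRep-separator i∈ r≢i)) i∉
    ... | simplicial σ i∈ = trans (cong-app (withSepRows-simplicial repRowδ δ i∈) j)
                                  (sym (cong-app (withSepRows-simplicial repRowδ diffRow i∈) j))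
    cancel : ∀ d e → d ≡ + 1 * (d - e) + + 1 * e
    cancel = solve-∀
    comb : ∀ i → isSepNonRep i ≡ true → ∀ j → M₄ i j ≡ ∑[ v < n ] (sepCoeff (+ 1) i v * M₃ v j)
    comb i i∈X j with rowKind i
    ... | representative σ refl with () ← trans (sym (isSepNonRep-rep σ)) i∈X
    ... | simplicial σ i∈ with () ← trans (sym (isSepNonRep-simplicial i∈)) i∈X
    ... | separator σ i∈ r≢i = begin
      M₄ i j
          ≡⟨ cong-app (withSepRows-separator repRowδ δ i∈ r≢i) j ⟩
      δ i j                                                           ≡⟨ cancel (δ i j) (δ (rep (sepOf i)) j) ⟩
      + 1 * (δ i j - δ (rep (sepOf i)) j) + + 1 * δ (rep (sepOf i)) j
        ≡⟨ cong₂ (λ t u → + 1 * t + + 1 * u) (cong-app (withSepRows-separator repRowδ diffRow i∈ r≢i) j)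
                                             (cong-app (withSepRows-rep repRowδ diffRow (sepOf i)) j) ⟨
      + 1 * M₃ i j + + 1 * M₃ (rep (sepOf i)) j                       ≡⟨ ∑-pair M₃ i (rep (sepOf i)) (+ 1) (+ 1) j ⟨
      ∑[ v < n ] (sepCoeff (+ 1) i v * M₃ v j)                         ∎

  det-M₃≡M₄ : det n M₃ ≡ det n M₄
  det-M₃≡M₄ = sym (trans det-M₄≡M₃ (trans (cong (_* det n M₃) (ℤ.^-zeroˡ (count isSepNonRep))) (ℤ.*-identityˡ _)))

  inP : Fin n → Bool
  inP v = isP (lab v)

  Simp-of : ∀ ℓ → isP ℓ ≡ true → Σ Side (λ σ → ℓ ≡ Simp σ)
  Simp-of P₁ _ = one , refl
  Simp-of P₂ _ = two , refl

  δ-inducedVerts : ∀ k l → δ (lookup (inducedVerts inP) k) (lookup (inducedVerts inP) l) ≡ δ k l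
  δ-inducedVerts k l with k ≟ l
  ... | yes refl = δ-refl (lookup (inducedVerts inP) k)
  ... | no k≢l   = δ-≢ (k≢l ∘ inducedVerts-injective inP k l)

  det-M₄≡H : det n M₄ ≡ charPoly (laplacian (inducedAdj adj inP)) (x - + s)
  det-M₄≡H = trans (det-restrict M₄ inP unit) (det-cong block)
    where
    H = inducedAdj adj inP
    L = lookup (inducedVerts inP)
    unit : ∀ u → inP u ≡ false → ∀ j → M₄ u j ≡ δ u j
    unit u u∉ j with rowKind u
    ... | representative σ refl = cong-app (withSepRows-rep repRowδ δ σ) j
    ... | separator σ u∈ r≢u = cong-app (withSepRows-separator repRowδ δ u∈ r≢u) j
    ... | simplicial σ u∈ with () ← trans (sym (trans (cong isP u∈) (isP-Simp σ))) u∉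
    degree-H : ∀ k → degree H k ≡ ∑[ w < n ] (𝟙P w * A (L k) w)
    degree-H k = trans (sumFin≡sum (λ l → A (L k) (L l))) (∑-inducedVerts inP (A (L k)))
    shift : ∀ d x s h e → d * (x - (s + h)) + e ≡ d * ((x - s) - h) + e
    shift = solve-∀
    block : ∀ k l → M₄ (L k) (L l) ≡ charMatrix H (x - + s) k l
    block k l with Simp-of (lab (L k)) (inducedVerts-sound inP k)
    ... | σ , k∈ = begin
      M₄ (L k) (L l)                                             ≡⟨ cong-app (withSepRows-simplicial repRowδ δ k∈) (L l) ⟩
      M (L k) (L l)                                              ≡⟨ charMatrix-entry G x (L k) (L l) ⟩
      δ (L k) (L l) * (x - degree adj (L k)) + A (L k) (L l)
          ≡⟨ cong₂ (λ d e → d * (x - e) + A (L k) (L l)) (δ-inducedVerts k l) (degree-Simp σ k∈) ⟩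
      δ k l * (x - (+ s + ∑[ w < n ] (𝟙P w * A (L k) w))) + A (L k) (L l)
          ≡⟨ cong (λ h → δ k l * (x - (+ s + h)) + A (L k) (L l)) (degree-H k) ⟨
      δ k l * (x - (+ s + degree H k)) + A (L k) (L l)           ≡⟨ shift (δ k l) x (+ s) (degree H k) (A (L k) (L l)) ⟩
      δ k l * ((x - + s) - degree H k) + b2z (H k l)
          ≡⟨ charMatrix-entry (inducedAdj-simple G inP) (x - + s) k l ⟨
      charMatrix H (x - + s) k l                                 ∎

  rep-indicator : ∀ i → b2z (isRep i) ≡ δ (rep one) i + δ (rep two) i
  rep-indicator i with rep one ≟ i | rep two ≟ i
  ... | yes refl | yes r₂≡r₁ = ⊥-elim (rep-distinct (sym r₂≡r₁))
  ... | yes _    | no _      = refl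
  ... | no _     | yes _     = refl
  ... | no _     | no _      = refl

  count-isRep : count isRep ≡ 2
  count-isRep = ℤ.+-injective (begin
    + count isRep                                              ≡⟨ count-as-∑ isRep ⟩
    ∑[ i < n ] b2z (isRep i)                                   ≡⟨ sum-cong-≗ rep-indicator ⟩
    ∑[ i < n ] (δ (rep one) i + δ (rep two) i)                 ≡⟨ ∑-distrib-+ (δ (rep one)) (δ (rep two)) ⟩
    ∑[ i < n ] δ (rep one) i + ∑[ i < n ] δ (rep two) i        ≡⟨ cong₂ _+_ (∑-δ₁ (rep one)) (∑-δ₁ (rep two)) ⟩
    + 2                                                        ∎)

  separator-partition : ∀ i → b2z (isSepNonRep i) + b2z (isRep i) ≡ 𝟙S i
  separator-partition i with rowKind i
  ... | representative σ refl rewrite isSepNonRep-rep σ | isRep-rep σ | rep-lab σ | isS-Sep σ = refl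
  ... | separator σ i∈ r≢i
    rewrite isSepNonRep-separator i∈ r≢i | isRep-notRep (notRep-separator i∈ r≢i) | i∈ | isS-Sep σ = refl
  ... | simplicial σ i∈
    rewrite isSepNonRep-simplicial i∈ | isRep-notRep (notRep-simplicial i∈) | i∈ | isS-Simp σ = refl

  count-isSepNonRep : count isSepNonRep ℕ.+ 2 ≡ s ℕ.+ s
  count-isSepNonRep = ℤ.+-injective (begin
    + (count isSepNonRep ℕ.+ 2)                                ≡⟨ ℤ.pos-+ (count isSepNonRep) 2 ⟩
    + count isSepNonRep + + 2
        ≡⟨ cong₂ _+_ (count-as-∑ isSepNonRep) (trans (sym (cong +_ count-isRep)) (count-as-∑ isRep)) ⟩
    ∑[ i < n ] b2z (isSepNonRep i) + ∑[ i < n ] b2z (isRep i)  ≡⟨ ∑-distrib-+ (b2z ∘ isSepNonRep) (b2z ∘ isRep) ⟨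
    ∑[ i < n ] (b2z (isSepNonRep i) + b2z (isRep i))           ≡⟨ sum-cong-≗ separator-partition ⟩
    ∑[ i < n ] 𝟙S i                                            ≡⟨ ∑-𝟙S ⟩
    + s + + s                                                  ≡⟨ ℤ.pos-+ s s ⟨
    + (s ℕ.+ s)                                                ∎)

  charPoly-SICore : det n M * (b * b)
                    ≡ a ^ count isSepNonRep * ((κ + β) * (κ - β) * charPoly (laplacian (inducedAdj adj inP)) (x - + s))
  charPoly-SICore = begin
    det n M * (b * b)                                      ≡⟨ cong (_* (b * b)) det-M≡M₁ ⟩
    aᶜ * det n M₁ * (b * b)                                ≡⟨ regroup aᶜ (det n M₁) b ⟩
    aᶜ * (b ^ 2 * det n M₁)                                ≡⟨ cong (λ m → aᶜ * (b ^ m * det n M₁)) count-isRep ⟨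
    aᶜ * (b ^ count isRep * det n M₁)                      ≡⟨ cong (aᶜ *_) det-M₂≡M₁ ⟨
    aᶜ * det n M₂                                          ≡⟨ cong (aᶜ *_) det-M₂≡M₃ ⟩
    aᶜ * ((κ + β) * (κ - β) * det n M₃)
        ≡⟨ cong (λ d → aᶜ * ((κ + β) * (κ - β) * d)) (trans det-M₃≡M₄ det-M₄≡H) ⟩
    aᶜ * ((κ + β) * (κ - β) * charPoly (laplacian (inducedAdj adj inP)) (x - + s)) ∎
    where
    aᶜ = a ^ count isSepNonRep
    regroup : ∀ c d e → c * d * (e * e) ≡ c * (e * (e * + 1) * d)
    regroup = solve-∀

representatives : ∀ {s p n} {adj : Fin n → Fin n → Bool} {lab : Fin n → Part} → IsSICore (suc s) p adj lab →
  Σ (Side → Fin n) (λ rep → ∀ σ → lab (rep σ) ≡ Sep σ)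
representatives {lab = lab} core = rep , rep-lab
  where
  open IsSICore core using (card-S₁; card-S₂)
  u₁ = count≡suc⇒∃ (λ v → isLab S₁ (lab v)) card-S₁
  u₂ = count≡suc⇒∃ (λ v → isLab S₂ (lab v)) card-S₂
  rep : Side → Fin _
  rep one = proj₁ u₁
  rep two = proj₁ u₂
  rep-lab : ∀ σ → lab (rep σ) ≡ Sep σ
  rep-lab one = isLab-true S₁ (proj₂ u₁)
  rep-lab two = isLab-true S₂ (proj₂ u₂)

corollary5 : (s p n : ℕ) → 2 ≤ s → 2 ≤ p →
    (adj : Fin n → Fin n → Bool) → (lab : Fin n → Part) →
    IsSimpleGraph adj → IsSICore s p adj lab →
    NotMin adj lab → NotMax adj lab →
    (x : ℤ) →
      charPoly (laplacian adj) x * (x - + s) ^ 2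
      ≡ x
        * (x ^ 2 - (+ 3 * + s + + p) * x + + 2 * (+ s) ^ 2)
        * (x - (+ 2 * + s + + p)) ^ (twoSMinus2 s)
        * (x - (+ s + + p))
        * charPoly (laplacian (inducedAdj adj (λ v → isP (lab v)))) (x - + s)
corollary5 (suc s′) p n (s≤s _) _ adj lab G core _ _ x = begin
  det n M * b ^ 2                                        ≡⟨ cong (det n M *_) (square b) ⟩
  det n M * (b * b)                                      ≡⟨ charPoly-SICore ⟩
  a ^ count isSepNonRep * ((κ + β) * (κ - β) * H)        ≡⟨ cong (λ m → a ^ m * ((κ + β) * (κ - β) * H)) count≡ ⟩
  a ^ twoSMinus2 (suc s′) * ((κ + β) * (κ - β) * H)      ≡⟨ factor x (+ suc s′) (+ p) (a ^ twoSMinus2 (suc s′)) H ⟩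
  x * (x ^ 2 - (+ 3 * + suc s′ + + p) * x + + 2 * (+ suc s′) ^ 2) * a ^ twoSMinus2 (suc s′) * (x - (+ suc s′ + + p)) * H ∎
  where
  open SICore G core x (proj₁ (representatives core)) (proj₂ (representatives core))
  H = charPoly (laplacian (inducedAdj adj inP)) (x - + suc s′)
  count≡ : count isSepNonRep ≡ twoSMinus2 (suc s′)
  count≡ = +-cancelʳ-≡ 2 (count isSepNonRep) (2 ℕ.* s′) (trans count-isSepNonRep (double s′))
    where
    double : ∀ m → suc m ℕ.+ suc m ≡ 2 ℕ.* m ℕ.+ 2
    double = ℕ-Solver.solve-∀
  square : ∀ y → y ^ 2 ≡ y * y
  square y = cong (y *_) (ℤ.*-identityʳ y)
  factor : ∀ y t r c h →
    c * ((((y - t) * (y - (+ 2 * t + r)) + t * ((y - t) - r)) + t * (y - t))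
         * (((y - t) * (y - (+ 2 * t + r)) + t * ((y - t) - r)) - t * (y - t)) * h)
      ≡ y * (y ^ 2 - (+ 3 * t + r) * y + + 2 * t ^ 2) * c * (y - (t + r)) * h
  factor y t r c h rewrite square y | square t = polynomial y t r c h
    where
    polynomial : ∀ y t r c h →
      c * ((((y - t) * (y - (+ 2 * t + r)) + t * ((y - t) - r)) + t * (y - t))
           * (((y - t) * (y - (+ 2 * t + r)) + t * ((y - t) - r)) - t * (y - t)) * h)
        ≡ y * (y * y - (+ 3 * t + r) * y + + 2 * (t * t)) * c * (y - (t + r)) * h
    polynomial = solve-∀
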